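{- Let $H$ be a 3-uniform hypergraph on $n \geq 5$ vertices with $\delta_2^{\mathrm{ess}}(H) > 5n/6$. Then $\deg^{w_H}(p) = 1$ for every pair $p \in E(\partial H)$.
   Context: Let $H$ be a 3-uniform hypergraph. For a pair $p$ of vertices, $N(p)=\{v: p\cup\{v\}\in E(H)\}$ and $\deg(p)=|N(p)|$; $\partial H$ is the graph of pairs with $\deg(p)>0$; $\delta_2^{\mathrm{ess}}(H)=\min\{\deg(p): \deg(p)>0\}$. For $\psi\colon E(H)\to\mathbb{R}$, $\deg^\psi(p)=\sum_{e\in E(H),\,p\subseteq e}\psi(e)$. For $r\in\{3,4,5\}$ an $r$-clique of $H$ is an $r$-set of vertices all of whose 3-subsets are edges; for a vertex set $S$, $\mathcal{K}_r(H,S)$ is the set of $r$-cliques containing $S$. An ordered 5-clique is a 5-tuple $(v_1,\dots,v_5)$ of distinct vertices forming a 5-clique; for an edge $e$, $\mathcal{OK}_5(H,e)$ is the set of ordered 5-cliques whose vertex set contains $e$. For $r\in\{2,3,4\}$ and vertices $v_1,\dots,v_r$, the weight is $W(v_1,\dots,v_r)=\prod_{i=2}^{r} 1/|\mathcal{K}_{i+1}(H,\{v_1,\dots,v_i\})|$. For an ordered 5-clique $K=(v_1,\dots,v_5)$ and $e\in E(H)$, let $\psi_K(e)=1/3$ if $e\subseteq\{v_1,\dots,v_5\}$ and $|e\cap\{v_1,v_2\}|\in\{0,2\}$, $\psi_K(e)=-1/6$ if $e\subseteq\{v_1,\dots,v_5\}$ and $|e\cap\{v_1,v_2\}|=1$,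 and $\psi_K(e)=0$ otherwise. Define $w_H\colon E(H)\to\mathbb{R}$ by $w_H(e)=\frac12\sum_{K=(v_1,\dots,v_5)\in\mathcal{OK}_5(H,e)} W(v_1,\dots,v_4)\,\psi_K(e)$. -}

module Defs where

open import Data.Nat using (ℕ; zero; suc; _≡ᵇ_; _<_)
open import Data.Bool using (Bool; true; false; _∧_; _∨_; not; T; if_then_else_)
open import Data.Fin using (Fin; _≟_)
open import Data.Fin.Subset using (Subset; ⁅_⁆; _∪_; _∩_; ∣_∣; outside; inside; ⊥)
open import Data.Fin.Subset.Properties using (_⊆?_)
open import Data.Vec using (Vec; []; _∷_; lookup)
open import Data.List using (List; []; _∷_; map; filter; length; foldr; concatMap; allFin)
open import Data.Bool.Properties using (T?)
open import Data.Product using (_×_)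
open import Data.Integer using (+_)
open import Data.Rational using (ℚ; 0ℚ; _+_; _*_; _/_; -_)
open import Relation.Nullary using (does)
open import Relation.Binary.PropositionalEquality using (_≡_)

record Hypergraph3 (n : ℕ) : Set where
  field
    E        : Subset n → Bool
    uniform  : ∀ s → T (E s) → ∣ s ∣ ≡ 3

open Hypergraph3 public

allSubsets : ∀ n → List (Subset n)
allSubsets zero    = [] ∷ []
allSubsets (suc n) = concatMap (λ s → (outside ∷ s) ∷ (inside ∷ s) ∷ []) (allSubsets n)

allᵇ : ∀ {A : Set} → (A → Bool) → List A → Bool
allᵇ f = foldr (λ x b → f x ∧ b) true

_⊆ᵇ_ : ∀ {n} → Subset n → Subset n → Bool
s ⊆ᵇ t = does (s ⊆? t)

sumℚ : List ℚ → ℚ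
sumℚ = foldr _+_ 0ℚ

-- reciprocal of a natural number (only ever applied to positive numbers below)
recip : ℕ → ℚ
recip zero    = 0ℚ
recip (suc k) = (+ 1) / suc k

module _ {n : ℕ} (H : Hypergraph3 n) where

  edges : List (Subset n)
  edges = filter (λ s → T? (E H s)) (allSubsets n)

  deg : Subset n → ℕ
  deg p = length (filter (λ v → T? (E H (p ∪ ⁅ v ⁆))) (allFin n))

  InShadow : Subset n → Set
  InShadow p = (∣ p ∣ ≡ 2) × (0 < deg p)

  isCliqueᵇ : ℕ → Subset n → Bool
  isCliqueᵇ r s = (∣ s ∣ ≡ᵇ r) ∧
    allᵇ (λ t → not ((t ⊆ᵇ s) ∧ (∣ t ∣ ≡ᵇ 3)) ∨ E H t) (allSubsets n)

  cliquesContaining : ℕ → Subset n → List (Subset n)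
  cliquesContaining r S =
    filter (λ s → T? ((isCliqueᵇ r s) ∧ (S ⊆ᵇ s))) (allSubsets n)

  numCliques : ℕ → Subset n → ℕ
  numCliques r S = length (cliquesContaining r S)

  W4 : Fin n → Fin n → Fin n → Fin n → ℚ
  W4 v₁ v₂ v₃ v₄ =
    recip (numCliques 3 (⁅ v₁ ⁆ ∪ ⁅ v₂ ⁆)) *
    (recip (numCliques 4 (⁅ v₁ ⁆ ∪ ⁅ v₂ ⁆ ∪ ⁅ v₃ ⁆)) *
     recip (numCliques 5 (⁅ v₁ ⁆ ∪ ⁅ v₂ ⁆ ∪ ⁅ v₃ ⁆ ∪ ⁅ v₄ ⁆)))

  vset : Vec (Fin n) 5 → Subset n
  vset (a ∷ b ∷ c ∷ d ∷ e ∷ []) = ⁅ a ⁆ ∪ ⁅ b ⁆ ∪ ⁅ c ⁆ ∪ ⁅ d ⁆ ∪ ⁅ e ⁆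

  neqᵇ : Fin n → Fin n → Bool
  neqᵇ x y = not (does (x ≟ y))

  distinctᵇ : Vec (Fin n) 5 → Bool
  distinctᵇ (a ∷ b ∷ c ∷ d ∷ e ∷ []) =
    neqᵇ a b ∧ neqᵇ a c ∧ neqᵇ a d ∧ neqᵇ a e ∧
    neqᵇ b c ∧ neqᵇ b d ∧ neqᵇ b e ∧
    neqᵇ c d ∧ neqᵇ c e ∧ neqᵇ d e

  tuples5 : List (Vec (Fin n) 5)
  tuples5 = concatMap (λ a → concatMap (λ b → concatMap (λ c → concatMap (λ d →
              map (λ e → a ∷ b ∷ c ∷ d ∷ e ∷ []) (allFin n))
              (allFin n)) (allFin n)) (allFin n)) (allFin n)

  orderedCliques5 : Subset n → List (Vec (Fin n) 5)
  orderedCliques5 e =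
    filter (λ K → T? (distinctᵇ K ∧ isCliqueᵇ 5 (vset K) ∧ (e ⊆ᵇ vset K))) tuples5

  ψ : Vec (Fin n) 5 → Subset n → ℚ
  ψ K@(v₁ ∷ v₂ ∷ _) e =
    if E H e ∧ (e ⊆ᵇ vset K) then
      (if ∣ e ∩ (⁅ v₁ ⁆ ∪ ⁅ v₂ ⁆) ∣ ≡ᵇ 1 then - ((+ 1) / 6) else (+ 1) / 3)
    else 0ℚ

  w : Subset n → ℚ
  w e = ((+ 1) / 2) * sumℚ (map (λ K → W4 (lookup K Fin.zero) (lookup K (Fin.suc Fin.zero))
                                  (lookup K (Fin.suc (Fin.suc Fin.zero)))
                                  (lookup K (Fin.suc (Fin.suc (Fin.suc Fin.zero)))) * ψ K e)
                             (orderedCliques5 e))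
    where import Data.Fin as Fin

  degw : Subset n → ℚ
  degw p = sumℚ (map w (filter (λ e → T? (p ⊆ᵇ e)) edges))

-- For an ordered 5-clique K = (v₁, …, v₅) and a pair p ⊆ V(K), the ψ_K-weights of the three
-- edges of K through p sum to 1 if p = {v₁, v₂} and to 0 otherwise. Exchanging the order of
-- summation in deg^{w_H}(p) therefore leaves ½ Σ W(v₁, v₂, v₃, v₄) over the ordered 5-cliques
-- with (v₁, v₂) = (u, v) or (v, u), where p = {u, v}. Each of these two sums telescopes to 1:
-- summing over v₅ cancels the factor 1/|𝒦₅(H, {v₁, …, v₄})|, then over v₄ the next one, and so
-- on, provided every clique met on the way extends to a larger one. For p itself this is
-- p ∈ ∂H; a 3- or 4-clique has at most six pairs, whose neighbourhoods each miss fewer than n/6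
-- vertices by δ₂ > 5n/6, so they share a vertex that extends the clique.

module Submission where

open import Algebra.Bundles using (CommutativeMonoid)
open import Data.Bool using (Bool; true; false; _∧_; _∨_; not; if_then_else_)
open import Data.Bool.Properties using (T?)
import Data.Bool.Properties as Bool
open import Data.Fin using (Fin; zero; suc; #_)
import Data.Fin as Fin
import Data.Fin.Properties as Fin
open import Data.Fin.Subset using (Subset; ∣_∣; ⁅_⁆; _∪_; _∩_; ⊥; ⊤; _∈_; _∉_; _⊆_; Nonempty; inside; outside)
open import Data.Fin.Subset.Properties
open import Data.List using (List; []; _∷_; map; filter; length; concatMap; allFin; _++_)
open import Data.List.Membership.Propositional using () renaming (_∈_ to _∈ₗ_)
open import Data.List.Membership.Propositional.Properties using (∈-filter⁺; ∈-concatMap⁺)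
import Data.List.Properties as List
open import Data.List.Relation.Unary.Any using (here; there)
import Data.List.Relation.Unary.Any as Any
open import Data.Nat using (ℕ; zero; suc)
import Data.Nat as ℕ
import Data.Nat.Properties as ℕ
open import Data.Product using (∃; ∃₂; _×_; _,_; proj₁; proj₂)
open import Data.Rational using (ℚ; 0ℚ; 1ℚ)
open import Data.Sum using (inj₁; inj₂; [_,_])
open import Data.Vec using (Vec; []; _∷_; lookup; _∷ʳ_; tabulate)
import Data.Vec.Properties as Vec
open import Data.Vec.Relation.Unary.All using (All; []; _∷_)
import Data.Vec.Relation.Unary.All.Properties as All
open import Data.Vec.Relation.Unary.AllPairs using (AllPairs; []; _∷_)
import Data.Vec.Relation.Unary.AllPairs.Properties as AllPairs
open import Data.Vec.Relation.Unary.Unique.Propositional using (Unique)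
open import Data.Vec.Relation.Unary.Unique.Propositional.Properties using (lookup-injective)
open import Function using (_∘_; id; _$_; Equivalence; mk⇔)
open import Relation.Binary.PropositionalEquality using (_≡_; _≢_; refl; sym; trans; cong; cong₂; subst; subst₂; module ≡-Reasoning)
open import Relation.Nullary using (¬_; Dec; yes; no; does; contradiction)
open import Relation.Nullary.Decidable using (dec-true; dec-false; does-⇔)

open import Defs

_≟ᵇ_ : ∀ {n} → Fin n → Fin n → Bool
x ≟ᵇ y = does (x Fin.≟ y)

private variable
  n m : ℕ

does≡true⇒ : {A : Set} (a? : Dec A) → does a? ≡ true → A
does≡true⇒ (yes a) _ = a

≡ᵇ⇒≡ : ∀ {i j} → (i ℕ.≡ᵇ j) ≡ true → i ≡ j
≡ᵇ⇒≡ {i} {j} = does≡true⇒ (i ℕ.≟ j)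

≡⇒≡ᵇ : ∀ {i j} → i ≡ j → (i ℕ.≡ᵇ j) ≡ true
≡⇒≡ᵇ {i} {j} = dec-true (i ℕ.≟ j)

≢⇒≡ᵇ≡false : ∀ {i j} → i ≢ j → (i ℕ.≡ᵇ j) ≡ false
≢⇒≡ᵇ≡false {i} {j} = dec-false (i ℕ.≟ j)

≟ᵇ-injective : {f : Fin m → Fin n} → (∀ i j → f i ≡ f j → i ≡ j) → ∀ i j → f i ≟ᵇ f j ≡ i ≟ᵇ j
≟ᵇ-injective {f = f} f-inj i j = does-⇔ (mk⇔ (f-inj i j) (cong f)) (f i Fin.≟ f j) (i Fin.≟ j)

∧≡true⁻ : ∀ {a b} → a ∧ b ≡ true → a ≡ true × b ≡ true
∧≡true⁻ {true} b≡true = refl , b≡true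

∧≡true⁺ : ∀ {a b} → a ≡ true → b ≡ true → a ∧ b ≡ true
∧≡true⁺ refl b≡true = b≡true

-- Finite sums of rationals

module _ where

  open import Data.Rational using (_+_; _*_; _/_; mkℚ)

  import Data.Integer as ℤ
  import Data.Integer.Properties as ℤ
  import Data.Nat.Coprimality as Coprime
  import Data.Rational.Properties as ℚ
  open CommutativeMonoid ℚ.+-0-commutativeMonoid using (commutativeSemigroup)
  open import Algebra.Properties.CommutativeSemigroup commutativeSemigroup using () renaming (interchange to +-interchange)

  ∑ : {A : Set} → List A → (A → ℚ) → ℚ
  ∑ l f = sumℚ (map f l)

  syntax ∑ l (λ x → e) = ∑[ x ← l ] e

  𝟙 : Bool → ℚ
  𝟙 true  = 1ℚ
  𝟙 false = 0ℚ

  module _ {A : Set} where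

    ∑-cong : (l : List A) {f g : A → ℚ} → (∀ x → f x ≡ g x) → ∑ l f ≡ ∑ l g
    ∑-cong []      f≗g = refl
    ∑-cong (x ∷ l) f≗g = cong₂ _+_ (f≗g x) (∑-cong l f≗g)

    ∑-zero : (l : List A) {f : A → ℚ} → (∀ x → f x ≡ 0ℚ) → ∑ l f ≡ 0ℚ
    ∑-zero []      f≗0 = refl
    ∑-zero (x ∷ l) f≗0 = cong₂ _+_ (f≗0 x) (∑-zero l f≗0)

    ∑-++ : (l m : List A) (f : A → ℚ) → ∑ (l ++ m) f ≡ ∑ l f + ∑ m f
    ∑-++ []      m f = sym (ℚ.+-identityˡ _)
    ∑-++ (x ∷ l) m f = trans (cong (f x +_) (∑-++ l m f)) (sym (ℚ.+-assoc (f x) _ _))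

    ∑-+ : (l : List A) (f g : A → ℚ) → ∑[ x ← l ] (f x + g x) ≡ ∑ l f + ∑ l g
    ∑-+ []      f g = refl
    ∑-+ (x ∷ l) f g = trans (cong (f x + g x +_) (∑-+ l f g)) (+-interchange (f x) (g x) _ _)

    ∑-*ˡ : (l : List A) (c : ℚ) (f : A → ℚ) → ∑[ x ← l ] (c * f x) ≡ c * ∑ l f
    ∑-*ˡ []      c f = sym (ℚ.*-zeroʳ c)
    ∑-*ˡ (x ∷ l) c f = trans (cong (c * f x +_) (∑-*ˡ l c f)) (sym (ℚ.*-distribˡ-+ c (f x) _))

    ∑-filter : (l : List A) (P : A → Bool) (f : A → ℚ) →
      ∑ (filter (T? ∘ P) l) f ≡ ∑[ x ← l ] (𝟙 (P x) * f x)
    ∑-filter []      P f = refl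
    ∑-filter (x ∷ l) P f with P x
    ... | true  = cong₂ _+_ (sym (ℚ.*-identityˡ (f x))) (∑-filter l P f)
    ... | false = trans (∑-filter l P f) (sym (trans (cong (_+ _) (ℚ.*-zeroˡ (f x))) (ℚ.+-identityˡ _)))

  module _ {A B : Set} where

    ∑-map : (l : List A) (g : A → B) (f : B → ℚ) → ∑ (map g l) f ≡ ∑ l (f ∘ g)
    ∑-map []      g f = refl
    ∑-map (x ∷ l) g f = cong (f (g x) +_) (∑-map l g f)

    ∑-concatMap : (l : List A) (g : A → List B) (f : B → ℚ) →
      ∑ (concatMap g l) f ≡ ∑[ x ← l ] ∑ (g x) f
    ∑-concatMap []      g f = refl
    ∑-concatMap (x ∷ l) g f = trans (∑-++ (g x) (concatMap g l) f) (cong (∑ (g x) f +_) (∑-concatMap l g f))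

    ∑-comm : (l : List A) (m : List B) (f : A → B → ℚ) →
      ∑[ x ← l ] ∑[ y ← m ] f x y ≡ ∑[ y ← m ] ∑[ x ← l ] f x y
    ∑-comm []      m f = sym (∑-zero m (λ _ → refl))
    ∑-comm (x ∷ l) m f = trans (cong (∑ m (f x) +_) (∑-comm l m f)) (sym (∑-+ m (f x) _))

  ∑-allFin-suc : ∀ n (f : Fin (suc n) → ℚ) → ∑ (allFin (suc n)) f ≡ f zero + ∑[ i ← allFin n ] f (suc i)
  ∑-allFin-suc n f = cong (λ l → f zero + sumℚ l) (trans (List.map-tabulate suc f) (sym (List.map-tabulate id (f ∘ suc))))

  𝟙-∧ : ∀ a b → 𝟙 (a ∧ b) ≡ 𝟙 a * 𝟙 b
  𝟙-∧ true  b = sym (ℚ.*-identityˡ (𝟙 b))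
  𝟙-∧ false b = sym (ℚ.*-zeroˡ (𝟙 b))

  𝟙*≡0 : ∀ {b} (x : ℚ) → b ≡ false → 𝟙 b * x ≡ 0ℚ
  𝟙*≡0 x refl = ℚ.*-zeroˡ x

  𝟙≡0 : ∀ c → ¬ (c ≡ true) → 𝟙 c ≡ 0ℚ
  𝟙≡0 false _      = refl
  𝟙≡0 true  c≢true = contradiction refl c≢true

  𝟙-absorb : ∀ c b → (c ≡ true → b ≡ true) → 𝟙 c ≡ 𝟙 b * 𝟙 c
  𝟙-absorb false b _   = sym (ℚ.*-zeroʳ (𝟙 b))
  𝟙-absorb true  b c⇒b rewrite c⇒b refl = sym (ℚ.*-identityˡ 1ℚ)

  𝟙-restrict : ∀ a b c → (c ≡ true → a ≡ true) → 𝟙 (a ∧ b) * 𝟙 c ≡ 𝟙 (c ∧ b)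
  𝟙-restrict a b false _   = ℚ.*-zeroʳ (𝟙 (a ∧ b))
  𝟙-restrict a b true  c⇒a rewrite c⇒a refl = ℚ.*-identityʳ (𝟙 b)

  ∑-δ : ∀ {n} (x : Fin n) (f : Fin n → ℚ) → ∑[ z ← allFin n ] (𝟙 (z ≟ᵇ x) * f z) ≡ f x
  ∑-δ {suc n} zero f = begin
    ∑[ z ← allFin (suc n) ] (𝟙 (z ≟ᵇ zero) * f z) ≡⟨ ∑-allFin-suc n (λ z → 𝟙 (z ≟ᵇ zero) * f z) ⟩
    1ℚ * f zero + ∑[ z ← allFin n ] (0ℚ * f (suc z))
      ≡⟨ cong₂ _+_ (ℚ.*-identityˡ (f zero)) (∑-zero (allFin n) (λ z → ℚ.*-zeroˡ (f (suc z)))) ⟩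
    f zero + 0ℚ                                      ≡⟨ ℚ.+-identityʳ (f zero) ⟩
    f zero                                           ∎
    where open ≡-Reasoning
  ∑-δ {suc n} (suc x) f = begin
    ∑[ z ← allFin (suc n) ] (𝟙 (z ≟ᵇ suc x) * f z)               ≡⟨ ∑-allFin-suc n (λ z → 𝟙 (z ≟ᵇ suc x) * f z) ⟩
    0ℚ * f zero + ∑[ z ← allFin n ] (𝟙 (z ≟ᵇ x) * f (suc z)) ≡⟨ cong₂ _+_ (ℚ.*-zeroˡ (f zero)) (∑-δ x (f ∘ suc)) ⟩
    0ℚ + f (suc x)                                            ≡⟨ ℚ.+-identityˡ (f (suc x)) ⟩
    f (suc x)                                                 ∎
    where open ≡-Reasoning

  𝟙*-cong : ∀ c {x y} → (c ≡ true → x ≡ y) → 𝟙 c * x ≡ 𝟙 c * y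
  𝟙*-cong false {x} {y} _   = trans (ℚ.*-zeroˡ x) (sym (ℚ.*-zeroˡ y))
  𝟙*-cong true          x≡y = cong (1ℚ *_) (x≡y refl)

  ∑∑-δ-pair : ∀ {n} (u v : Fin n) (R : Fin n → Fin n → ℚ) →
    ∑[ a ← allFin n ] ∑[ b ← allFin n ] ((𝟙 ((a ≟ᵇ u) ∧ (b ≟ᵇ v)) + 𝟙 ((a ≟ᵇ v) ∧ (b ≟ᵇ u))) * R a b) ≡ R u v + R v u
  ∑∑-δ-pair {n} u v R = begin
    ∑[ a ← allFin n ] ∑[ b ← allFin n ] ((𝟙 ((a ≟ᵇ u) ∧ (b ≟ᵇ v)) + 𝟙 ((a ≟ᵇ v) ∧ (b ≟ᵇ u))) * R a b)
      ≡⟨ ∑-cong (allFin n) (λ a → trans (∑-cong (allFin n) (split a)) (∑-+ (allFin n) _ _)) ⟩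
    ∑[ a ← allFin n ] (∑[ b ← allFin n ] (𝟙 (a ≟ᵇ u) * (𝟙 (b ≟ᵇ v) * R a b))
                       + ∑[ b ← allFin n ] (𝟙 (a ≟ᵇ v) * (𝟙 (b ≟ᵇ u) * R a b)))
      ≡⟨ ∑-+ (allFin n) _ _ ⟩
    ∑[ a ← allFin n ] ∑[ b ← allFin n ] (𝟙 (a ≟ᵇ u) * (𝟙 (b ≟ᵇ v) * R a b))
      + ∑[ a ← allFin n ] ∑[ b ← allFin n ] (𝟙 (a ≟ᵇ v) * (𝟙 (b ≟ᵇ u) * R a b))
      ≡⟨ cong₂ _+_ (δδ u v) (δδ v u) ⟩
    R u v + R v u ∎
    where
    open ≡-Reasoning
    split : ∀ a b → (𝟙 ((a ≟ᵇ u) ∧ (b ≟ᵇ v)) + 𝟙 ((a ≟ᵇ v) ∧ (b ≟ᵇ u))) * R a b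
                  ≡ 𝟙 (a ≟ᵇ u) * (𝟙 (b ≟ᵇ v) * R a b) + 𝟙 (a ≟ᵇ v) * (𝟙 (b ≟ᵇ u) * R a b)
    split a b = trans (ℚ.*-distribʳ-+ (R a b) (𝟙 ((a ≟ᵇ u) ∧ (b ≟ᵇ v))) (𝟙 ((a ≟ᵇ v) ∧ (b ≟ᵇ u)))) (cong₂ _+_
      (trans (cong (_* R a b) (𝟙-∧ (a ≟ᵇ u) (b ≟ᵇ v))) (ℚ.*-assoc (𝟙 (a ≟ᵇ u)) (𝟙 (b ≟ᵇ v)) (R a b)))
      (trans (cong (_* R a b) (𝟙-∧ (a ≟ᵇ v) (b ≟ᵇ u))) (ℚ.*-assoc (𝟙 (a ≟ᵇ v)) (𝟙 (b ≟ᵇ u)) (R a b))))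
    δδ : ∀ x y → ∑[ a ← allFin n ] ∑[ b ← allFin n ] (𝟙 (a ≟ᵇ x) * (𝟙 (b ≟ᵇ y) * R a b)) ≡ R x y
    δδ x y = trans (∑-cong (allFin n) (λ a → trans (∑-*ˡ (allFin n) (𝟙 (a ≟ᵇ x)) _) (cong (𝟙 (a ≟ᵇ x) *_) (∑-δ y (R a)))))
                   (∑-δ x (λ a → R a y))

  fromℕ : ℕ → ℚ
  fromℕ m = ℤ.+ m / 1

  fromℕ≡mkℚ : ∀ m → fromℕ m ≡ mkℚ (ℤ.+ m) 0 (Coprime.sym (Coprime.1-coprimeTo m))
  fromℕ≡mkℚ m = ℚ.normalize-coprime (Coprime.sym (Coprime.1-coprimeTo m))

  fromℕ-suc : ∀ m → fromℕ (suc m) ≡ 1ℚ + fromℕ m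
  fromℕ-suc m rewrite fromℕ≡mkℚ m = ℚ./-cong {q₁ = 1} (cong (ℤ._+_ ℤ.1ℤ) (sym (ℤ.*-identityʳ (ℤ.+ m)))) refl

  length-filter : {A : Set} (l : List A) (P : A → Bool) → fromℕ (length (filter (T? ∘ P) l)) ≡ ∑[ x ← l ] 𝟙 (P x)
  length-filter []      P = refl
  length-filter (x ∷ l) P with P x
  ... | true  = trans (fromℕ-suc (length (filter (T? ∘ P) l))) (cong (1ℚ +_) (length-filter l P))
  ... | false = trans (length-filter l P) (sym (ℚ.+-identityˡ _))

  recip-cancel : ∀ N b → (b ≡ true → 0 ℕ.< N) → recip N * (𝟙 b * fromℕ N) ≡ 𝟙 b
  recip-cancel N       false _   = trans (cong (recip N *_) (ℚ.*-zeroˡ (fromℕ N))) (ℚ.*-zeroʳ (recip N))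
  recip-cancel (suc k) true  _   = begin
    recip (suc k) * (1ℚ * fromℕ (suc k))
      ≡⟨ cong₂ (λ r c → r * (1ℚ * c)) (ℚ.normalize-coprime (Coprime.1-coprimeTo (suc k))) (fromℕ≡mkℚ (suc k)) ⟩
    1/q * (1ℚ * q)                         ≡⟨ cong (1/q *_) (ℚ.*-identityˡ q) ⟩
    1/q * q                                ≡⟨ ℚ.*-inverseˡ q ⟩
    1ℚ                                     ∎
    where
    open ≡-Reasoning
    q : ℚ
    q = mkℚ (ℤ.+ suc k) 0 (Coprime.sym (Coprime.1-coprimeTo (suc k)))
    1/q : ℚ
    1/q = mkℚ (ℤ.+ 1) k (Coprime.1-coprimeTo (suc k))
  recip-cancel zero    true  0<0 with 0<0 refl
  ... | ()

-- Finite subsets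

𝟙ℕ : Bool → ℕ
𝟙ℕ true  = 1
𝟙ℕ false = 0

module _ where

  open import Data.Nat using (_+_; _≤_; _<_; z≤n; s≤s)
  open import Data.Vec using (here; there)

  lookup-⁅⁆ : (y x : Fin n) → lookup ⁅ y ⁆ x ≡ x ≟ᵇ y
  lookup-⁅⁆ zero    zero    = refl
  lookup-⁅⁆ zero    (suc x) = Vec.lookup-replicate x false
  lookup-⁅⁆ (suc y) zero    = refl
  lookup-⁅⁆ (suc y) (suc x) = lookup-⁅⁆ y x

  lookup-∪ : (p q : Subset n) (x : Fin n) → lookup (p ∪ q) x ≡ lookup p x ∨ lookup q x
  lookup-∪ p q x = Vec.lookup-zipWith _∨_ x p q

  ∉⇒lookup≡false : ∀ {p : Subset n} {x} → x ∉ p → lookup p x ≡ false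
  ∉⇒lookup≡false {p = p} {x} x∉p with lookup p x in eq
  ... | false = refl
  ... | true  = contradiction (Vec.lookup⇒[]= x p eq) x∉p

  p∪⁅x⁆≡p : ∀ {p : Subset n} {x} → x ∈ p → p ∪ ⁅ x ⁆ ≡ p
  p∪⁅x⁆≡p {p = inside ∷ p} here        = cong (inside ∷_) (∪-identityʳ p)
  p∪⁅x⁆≡p {p = b ∷ p}      (there x∈p) = cong₂ _∷_ (Bool.∨-identityʳ b) (p∪⁅x⁆≡p x∈p)

  ∣p∪⁅x⁆∣≡1+∣p∣ : ∀ {p : Subset n} {x} → x ∉ p → ∣ p ∪ ⁅ x ⁆ ∣ ≡ suc ∣ p ∣
  ∣p∪⁅x⁆∣≡1+∣p∣ {p = outside ∷ p} {zero}  _   = cong (suc ∘ ∣_∣) (∪-identityʳ p)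
  ∣p∪⁅x⁆∣≡1+∣p∣ {p = inside  ∷ p} {zero}  x∉p = contradiction here x∉p
  ∣p∪⁅x⁆∣≡1+∣p∣ {p = outside ∷ p} {suc x} x∉p = ∣p∪⁅x⁆∣≡1+∣p∣ (x∉p ∘ there)
  ∣p∪⁅x⁆∣≡1+∣p∣ {p = inside  ∷ p} {suc x} x∉p = cong suc (∣p∪⁅x⁆∣≡1+∣p∣ (x∉p ∘ there))

  ∣p∪⁅x⁆∣≤1+∣p∣ : (p : Subset n) (x : Fin n) → ∣ p ∪ ⁅ x ⁆ ∣ ≤ suc ∣ p ∣
  ∣p∪⁅x⁆∣≤1+∣p∣ p x with x ∈? p
  ... | yes x∈p = subst (_≤ suc ∣ p ∣) (cong ∣_∣ (sym (p∪⁅x⁆≡p x∈p))) (ℕ.n≤1+n ∣ p ∣)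
  ... | no  x∉p = ℕ.≤-reflexive (∣p∪⁅x⁆∣≡1+∣p∣ x∉p)

  ∣⁅x⁆∪⁅y⁆∣≡2 : ∀ {x y : Fin n} → x ≢ y → ∣ ⁅ x ⁆ ∪ ⁅ y ⁆ ∣ ≡ 2
  ∣⁅x⁆∪⁅y⁆∣≡2 {x = x} x≢y = trans (∣p∪⁅x⁆∣≡1+∣p∣ (x≢y⇒x∉⁅y⁆ (x≢y ∘ sym))) (cong suc (∣⁅x⁆∣≡1 x))

  ∣p∣≡0⇒p≡⊥ : ∀ {p : Subset n} → ∣ p ∣ ≡ 0 → p ≡ ⊥
  ∣p∣≡0⇒p≡⊥ {p = []}          _   = refl
  ∣p∣≡0⇒p≡⊥ {p = outside ∷ p} ∣p∣≡0 = cong (outside ∷_) (∣p∣≡0⇒p≡⊥ ∣p∣≡0)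

  ∣p∣≡1⇒singleton : ∀ {p : Subset n} → ∣ p ∣ ≡ 1 → ∃ λ x → p ≡ ⁅ x ⁆
  ∣p∣≡1⇒singleton {p = inside  ∷ p} ∣p∣≡1 = zero , cong (inside ∷_) (∣p∣≡0⇒p≡⊥ (ℕ.suc-injective ∣p∣≡1))
  ∣p∣≡1⇒singleton {p = outside ∷ p} ∣p∣≡1 with ∣p∣≡1⇒singleton {p = p} ∣p∣≡1
  ... | x , refl = suc x , refl

  ∣p∣≡2⇒pair : ∀ {p : Subset n} → ∣ p ∣ ≡ 2 → ∃₂ λ x y → x ≢ y × p ≡ ⁅ x ⁆ ∪ ⁅ y ⁆
  ∣p∣≡2⇒pair {p = inside ∷ p} ∣p∣≡2 with ∣p∣≡1⇒singleton {p = p} (ℕ.suc-injective ∣p∣≡2)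
  ... | y , refl = zero , suc y , (λ ()) , cong (inside ∷_) (sym (∪-identityˡ ⁅ y ⁆))
  ∣p∣≡2⇒pair {p = outside ∷ p} ∣p∣≡2 with ∣p∣≡2⇒pair {p = p} ∣p∣≡2
  ... | x , y , x≢y , refl = suc x , suc y , x≢y ∘ Fin.suc-injective , refl

  ⊆∧∣q∣≤∣p∣⇒≡ : ∀ {p q : Subset n} → p ⊆ q → ∣ q ∣ ≤ ∣ p ∣ → p ≡ q
  ⊆∧∣q∣≤∣p∣⇒≡ {p = []}          {[]}          _   _ = refl
  ⊆∧∣q∣≤∣p∣⇒≡ {p = outside ∷ p} {outside ∷ q} p⊆q ∣q∣≤∣p∣ =
    cong (outside ∷_) (⊆∧∣q∣≤∣p∣⇒≡ (drop-∷-⊆ p⊆q) ∣q∣≤∣p∣)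
  ⊆∧∣q∣≤∣p∣⇒≡ {p = outside ∷ p} {inside  ∷ q} p⊆q ∣q∣≤∣p∣ =
    contradiction (ℕ.≤-trans ∣q∣≤∣p∣ (p⊆q⇒∣p∣≤∣q∣ (drop-∷-⊆ p⊆q))) ℕ.1+n≰n
  ⊆∧∣q∣≤∣p∣⇒≡ {p = inside  ∷ p} {outside ∷ q} p⊆q _ = contradiction (p⊆q here) λ ()
  ⊆∧∣q∣≤∣p∣⇒≡ {p = inside  ∷ p} {inside  ∷ q} p⊆q ∣q∣≤∣p∣ =
    cong (inside ∷_) (⊆∧∣q∣≤∣p∣⇒≡ (drop-∷-⊆ p⊆q) (ℕ.≤-pred ∣q∣≤∣p∣))

  ⊆-∪⁅⁆⁻ : ∀ {t p : Subset n} {x} → t ⊆ p ∪ ⁅ x ⁆ → x ∉ t → t ⊆ p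
  ⊆-∪⁅⁆⁻ {p = p} {x} t⊆p∪x x∉t y∈t =
    [ id , (λ y∈⁅x⁆ → contradiction (subst (_∈ _) (x∈⁅y⁆⇒x≡y x y∈⁅x⁆) y∈t) x∉t) ] (x∈p∪q⁻ p ⁅ x ⁆ (t⊆p∪x y∈t))

  ⊆-∪⁅⁆-split : ∀ {t p : Subset n} {x} → t ⊆ p ∪ ⁅ x ⁆ → x ∈ t → t ≡ (t ∩ p) ∪ ⁅ x ⁆
  ⊆-∪⁅⁆-split {t = t} {p} {x} t⊆p∪x x∈t = ⊆-antisym
    (λ y∈t → x∈p∪q⁺ ([ (λ y∈p → inj₁ (x∈p∩q⁺ (y∈t , y∈p))) , inj₂ ] (x∈p∪q⁻ p ⁅ x ⁆ (t⊆p∪x y∈t))))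
    (λ y∈ → [ proj₁ ∘ x∈p∩q⁻ t p , (λ y∈⁅x⁆ → subst (_∈ t) (sym (x∈⁅y⁆⇒x≡y x y∈⁅x⁆)) x∈t) ]
              (x∈p∪q⁻ (t ∩ p) ⁅ x ⁆ y∈))

  ∣p∣+∣q∣≤∣p∩q∣+n : (p q : Subset n) → ∣ p ∣ + ∣ q ∣ ≤ ∣ p ∩ q ∣ + n
  ∣p∣+∣1+q∣≤∣p∩q∣+1+n : (p q : Subset n) → ∣ p ∣ + suc ∣ q ∣ ≤ ∣ p ∩ q ∣ + suc n
  ∣p∣+∣q∣≤∣p∩q∣+n []            []            = z≤n
  ∣p∣+∣q∣≤∣p∩q∣+n (outside ∷ p) (outside ∷ q) =
    ℕ.≤-trans (∣p∣+∣q∣≤∣p∩q∣+n p q) (ℕ.+-monoʳ-≤ ∣ p ∩ q ∣ (ℕ.n≤1+n _))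
  ∣p∣+∣q∣≤∣p∩q∣+n (outside ∷ p) (inside  ∷ q) = ∣p∣+∣1+q∣≤∣p∩q∣+1+n p q
  ∣p∣+∣q∣≤∣p∩q∣+n (inside  ∷ p) (outside ∷ q) =
    ℕ.≤-trans (s≤s (∣p∣+∣q∣≤∣p∩q∣+n p q)) (ℕ.≤-reflexive (sym (ℕ.+-suc ∣ p ∩ q ∣ _)))
  ∣p∣+∣q∣≤∣p∩q∣+n (inside  ∷ p) (inside  ∷ q) = s≤s (∣p∣+∣1+q∣≤∣p∩q∣+1+n p q)

  ∣p∣+∣1+q∣≤∣p∩q∣+1+n {n} p q = begin
    ∣ p ∣ + suc ∣ q ∣   ≡⟨ ℕ.+-suc ∣ p ∣ ∣ q ∣ ⟩
    suc (∣ p ∣ + ∣ q ∣) ≤⟨ s≤s (∣p∣+∣q∣≤∣p∩q∣+n p q) ⟩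
    suc (∣ p ∩ q ∣ + n) ≡⟨ ℕ.+-suc ∣ p ∩ q ∣ n ⟨
    ∣ p ∩ q ∣ + suc n   ∎
    where open ℕ.≤-Reasoning

  ∣⁅x⁆∩q∣ : (x : Fin n) (q : Subset n) → ∣ ⁅ x ⁆ ∩ q ∣ ≡ 𝟙ℕ (lookup q x)
  ∣⁅x⁆∩q∣ {suc n} zero    (inside  ∷ q) = cong suc (trans (cong ∣_∣ (∩-zeroˡ q)) (∣⊥∣≡0 n))
  ∣⁅x⁆∩q∣ {suc n} zero    (outside ∷ q) = trans (cong ∣_∣ (∩-zeroˡ q)) (∣⊥∣≡0 n)
  ∣⁅x⁆∩q∣         (suc x) (_ ∷ q)       = ∣⁅x⁆∩q∣ x q

  ∣p∪⁅x⁆∩q∣ : ∀ {p : Subset n} {x} (q : Subset n) → x ∉ p → ∣ (p ∪ ⁅ x ⁆) ∩ q ∣ ≡ 𝟙ℕ (lookup q x) + ∣ p ∩ q ∣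
  ∣p∪⁅x⁆∩q∣ {p = outside ∷ p} {zero}  (inside  ∷ q) _   = cong (λ s → suc ∣ s ∩ q ∣) (∪-identityʳ p)
  ∣p∪⁅x⁆∩q∣ {p = outside ∷ p} {zero}  (outside ∷ q) _   = cong (λ s → ∣ s ∩ q ∣) (∪-identityʳ p)
  ∣p∪⁅x⁆∩q∣ {p = inside  ∷ p} {zero}  _             x∉p = contradiction here x∉p
  ∣p∪⁅x⁆∩q∣ {p = outside ∷ p} {suc x} (_ ∷ q)       x∉p = ∣p∪⁅x⁆∩q∣ q (x∉p ∘ there)
  ∣p∪⁅x⁆∩q∣ {p = inside  ∷ p} {suc x} (outside ∷ q) x∉p = ∣p∪⁅x⁆∩q∣ q (x∉p ∘ there)
  ∣p∪⁅x⁆∩q∣ {p = inside  ∷ p} {suc x} (inside  ∷ q) x∉p =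
    trans (cong suc (∣p∪⁅x⁆∩q∣ q (x∉p ∘ there))) (sym (ℕ.+-suc (𝟙ℕ (lookup q x)) _))

  ⁅x⁆⊆ : ∀ {p : Subset n} {x} → x ∈ p → ⁅ x ⁆ ⊆ p
  ⁅x⁆⊆ {p = p} {x} x∈p y∈⁅x⁆ = subst (_∈ p) (sym (x∈⁅y⁆⇒x≡y x y∈⁅x⁆)) x∈p

  ∪⊆ : ∀ {p q r : Subset n} → p ⊆ r → q ⊆ r → p ∪ q ⊆ r
  ∪⊆ {p = p} {q} p⊆r q⊆r y∈p∪q = [ p⊆r , q⊆r ] (x∈p∪q⁻ p q y∈p∪q)

  x∈p⇒0<∣p∣ : ∀ {p : Subset n} {x} → x ∈ p → 0 < ∣ p ∣
  x∈p⇒0<∣p∣ {x = x} x∈p = subst (_≤ _) (∣⁅x⁆∣≡1 x) (p⊆q⇒∣p∣≤∣q∣ (⁅x⁆⊆ x∈p))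

  ∣p∣>0⇒nonempty : ∀ {p : Subset n} → 0 < ∣ p ∣ → Nonempty p
  ∣p∣>0⇒nonempty {p = inside  ∷ p} _ = zero , here
  ∣p∣>0⇒nonempty {p = outside ∷ p} ∣p∣>0 with ∣p∣>0⇒nonempty {p = p} ∣p∣>0
  ... | x , x∈p = suc x , there x∈p

  ⊆ᵇ⇒⊆ : ∀ {p q : Subset n} → p ⊆ᵇ q ≡ true → p ⊆ q
  ⊆ᵇ⇒⊆ {p = p} {q} = does≡true⇒ (p ⊆? q)

  ⊆⇒⊆ᵇ : ∀ {p q : Subset n} → p ⊆ q → p ⊆ᵇ q ≡ true
  ⊆⇒⊆ᵇ {p = p} {q} = dec-true (p ⊆? q)

module _ where

  open import Data.Rational using (_+_; _*_)
  import Data.Rational.Properties as ℚ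
  open import Data.Nat using (_≡ᵇ_; s≤s)

  ∑-allSubsets-suc : ∀ n (f : Subset (suc n) → ℚ) →
    ∑ (allSubsets (suc n)) f ≡ ∑[ s ← allSubsets n ] (f (outside ∷ s) + f (inside ∷ s))
  ∑-allSubsets-suc n f = trans (∑-concatMap (allSubsets n) _ f)
    (∑-cong (allSubsets n) (λ s → cong (f (outside ∷ s) +_) (ℚ.+-identityʳ (f (inside ∷ s)))))

  ∑-⊇-sameSize : ∀ n (q : Subset n) (h : Subset n → ℚ) →
    ∑[ s ← allSubsets n ] (𝟙 ((∣ s ∣ ≡ᵇ ∣ q ∣) ∧ (q ⊆ᵇ s)) * h s) ≡ h q
  ∑-⊇-sameSize zero [] h = trans (cong (_+ 0ℚ) (ℚ.*-identityˡ (h []))) (ℚ.+-identityʳ (h []))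
  ∑-⊇-sameSize (suc n) (inside ∷ q) h = begin
    ∑[ s ← allSubsets (suc n) ] F s                     ≡⟨ ∑-allSubsets-suc n F ⟩
    ∑[ s ← allSubsets n ] (F (outside ∷ s) + F (inside ∷ s))
      ≡⟨ ∑-cong (allSubsets n) (λ s → trans (cong (_+ F (inside ∷ s)) (𝟙*≡0 _ (Bool.∧-zeroʳ (∣ s ∣ ≡ᵇ suc ∣ q ∣)))) (ℚ.+-identityˡ _)) ⟩
    ∑[ s ← allSubsets n ] F (inside ∷ s)                ≡⟨ ∑-⊇-sameSize n q (h ∘ (inside ∷_)) ⟩
    h (inside ∷ q)                                      ∎
    where
    open ≡-Reasoning
    F : Subset (suc n) → ℚ
    F s = 𝟙 ((∣ s ∣ ≡ᵇ ∣ inside ∷ q ∣) ∧ ((inside ∷ q) ⊆ᵇ s)) * h s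
  ∑-⊇-sameSize (suc n) (outside ∷ q) h = begin
    ∑[ s ← allSubsets (suc n) ] F s                     ≡⟨ ∑-allSubsets-suc n F ⟩
    ∑[ s ← allSubsets n ] (F (outside ∷ s) + F (inside ∷ s))
      ≡⟨ ∑-cong (allSubsets n) (λ s → trans (cong (F (outside ∷ s) +_) (𝟙*≡0 _ (tooLarge s))) (ℚ.+-identityʳ _)) ⟩
    ∑[ s ← allSubsets n ] F (outside ∷ s)               ≡⟨ ∑-⊇-sameSize n q (h ∘ (outside ∷_)) ⟩
    h (outside ∷ q)                                     ∎
    where
    open ≡-Reasoning
    F : Subset (suc n) → ℚ
    F s = 𝟙 ((∣ s ∣ ≡ᵇ ∣ outside ∷ q ∣) ∧ ((outside ∷ q) ⊆ᵇ s)) * h s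
    tooLarge : ∀ s → (suc ∣ s ∣ ≡ᵇ ∣ q ∣) ∧ (q ⊆ᵇ s) ≡ false
    tooLarge s with q ⊆ᵇ s in q⊆s
    ... | false = Bool.∧-zeroʳ _
    ... | true  = trans (Bool.∧-identityʳ _)
                    (≢⇒≡ᵇ≡false {suc ∣ s ∣} {∣ q ∣} (ℕ.<⇒≢ (s≤s (p⊆q⇒∣p∣≤∣q∣ (⊆ᵇ⇒⊆ {p = q} {s} q⊆s))) ∘ sym))

  ∑-⊇-oneLarger : ∀ n (q : Subset n) (h : Subset n → ℚ) →
    ∑[ s ← allSubsets n ] (𝟙 ((∣ s ∣ ≡ᵇ suc ∣ q ∣) ∧ (q ⊆ᵇ s)) * h s)
      ≡ ∑[ z ← allFin n ] (𝟙 (not (lookup q z)) * h (q ∪ ⁅ z ⁆))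
  ∑-⊇-oneLarger zero [] h = trans (cong (_+ 0ℚ) (ℚ.*-zeroˡ (h []))) (ℚ.+-identityʳ 0ℚ)
  ∑-⊇-oneLarger (suc n) (inside ∷ q) h = begin
    ∑[ s ← allSubsets (suc n) ] F s                     ≡⟨ ∑-allSubsets-suc n F ⟩
    ∑[ s ← allSubsets n ] (F (outside ∷ s) + F (inside ∷ s))
      ≡⟨ ∑-cong (allSubsets n) (λ s → trans (cong (_+ F (inside ∷ s)) (𝟙*≡0 _ (Bool.∧-zeroʳ (∣ s ∣ ≡ᵇ suc (suc ∣ q ∣))))) (ℚ.+-identityˡ _)) ⟩
    ∑[ s ← allSubsets n ] F (inside ∷ s)                ≡⟨ ∑-⊇-oneLarger n q (h ∘ (inside ∷_)) ⟩
    ∑[ z ← allFin n ] G (suc z)                         ≡⟨ ℚ.+-identityˡ rest ⟨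
    0ℚ + ∑[ z ← allFin n ] G (suc z)                    ≡⟨ cong (_+ rest) (ℚ.*-zeroˡ (h (inside ∷ (q ∪ ⊥)))) ⟨
    G zero + ∑[ z ← allFin n ] G (suc z)                ≡⟨ ∑-allFin-suc n G ⟨
    ∑[ z ← allFin (suc n) ] G z                         ∎
    where
    open ≡-Reasoning
    F : Subset (suc n) → ℚ
    F s = 𝟙 ((∣ s ∣ ≡ᵇ suc ∣ inside ∷ q ∣) ∧ ((inside ∷ q) ⊆ᵇ s)) * h s
    G : Fin (suc n) → ℚ
    G z = 𝟙 (not (lookup (inside ∷ q) z)) * h ((inside ∷ q) ∪ ⁅ z ⁆)
    rest : ℚ
    rest = ∑[ z ← allFin n ] G (suc z)
  ∑-⊇-oneLarger (suc n) (outside ∷ q) h = begin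
    ∑[ s ← allSubsets (suc n) ] F s                     ≡⟨ ∑-allSubsets-suc n F ⟩
    ∑[ s ← allSubsets n ] (F (outside ∷ s) + F (inside ∷ s))
      ≡⟨ ∑-+ (allSubsets n) (F ∘ (outside ∷_)) (F ∘ (inside ∷_)) ⟩
    ∑[ s ← allSubsets n ] F (outside ∷ s) + ∑[ s ← allSubsets n ] F (inside ∷ s)
      ≡⟨ cong₂ _+_ (∑-⊇-oneLarger n q (h ∘ (outside ∷_))) (∑-⊇-sameSize n q (h ∘ (inside ∷_))) ⟩
    ∑[ z ← allFin n ] G (suc z) + h (inside ∷ q)        ≡⟨ ℚ.+-comm rest (h (inside ∷ q)) ⟩
    h (inside ∷ q) + ∑[ z ← allFin n ] G (suc z)        ≡⟨ cong (λ r → h (inside ∷ r) + rest) (∪-identityʳ q) ⟨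
    h (inside ∷ (q ∪ ⊥)) + ∑[ z ← allFin n ] G (suc z)  ≡⟨ cong (_+ rest) (ℚ.*-identityˡ (h (inside ∷ (q ∪ ⊥)))) ⟨
    G zero + ∑[ z ← allFin n ] G (suc z)                ≡⟨ ∑-allFin-suc n G ⟨
    ∑[ z ← allFin (suc n) ] G z                         ∎
    where
    open ≡-Reasoning
    F : Subset (suc n) → ℚ
    F s = 𝟙 ((∣ s ∣ ≡ᵇ suc ∣ outside ∷ q ∣) ∧ ((outside ∷ q) ⊆ᵇ s)) * h s
    G : Fin (suc n) → ℚ
    G z = 𝟙 (not (lookup (outside ∷ q) z)) * h ((outside ∷ q) ∪ ⁅ z ⁆)
    rest : ℚ
    rest = ∑[ z ← allFin n ] G (suc z)

module _ {A : Set} where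

  open import Data.Nat using (_<_; s≤s; z≤n)

  allᵇ-sound : (f : A → Bool) {l : List A} {x : A} → allᵇ f l ≡ true → x ∈ₗ l → f x ≡ true
  allᵇ-sound f eq (here refl) = proj₁ (∧≡true⁻ eq)
  allᵇ-sound f eq (there x∈l) = allᵇ-sound f (proj₂ (∧≡true⁻ eq)) x∈l

  allᵇ-complete : (f : A → Bool) (l : List A) → (∀ x → f x ≡ true) → allᵇ f l ≡ true
  allᵇ-complete f []      _     = refl
  allᵇ-complete f (x ∷ l) f≡true = ∧≡true⁺ (f≡true x) (allᵇ-complete f l f≡true)

  0<length-filter : (P : A → Bool) {l : List A} {x : A} → x ∈ₗ l → P x ≡ true → 0 < length (filter (T? ∘ P) l)
  0<length-filter P x∈l Px = nonempty (∈-filter⁺ (T? ∘ P) x∈l (Equivalence.from Bool.T-≡ Px))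
    where
    nonempty : ∀ {y : A} {l} → y ∈ₗ l → 0 < length l
    nonempty (here _)  = s≤s z≤n
    nonempty (there _) = s≤s z≤n

consEither : Subset n → List (Subset (suc n))
consEither s = (outside ∷ s) ∷ (inside ∷ s) ∷ []

∈-allSubsets : (s : Subset n) → s ∈ₗ allSubsets n
∈-allSubsets []            = here refl
∈-allSubsets (outside ∷ s) = ∈-concatMap⁺ consEither (Any.map (λ s≡t → here (cong (outside ∷_) s≡t)) (∈-allSubsets s))
∈-allSubsets (inside ∷ s)  = ∈-concatMap⁺ consEither (Any.map (λ s≡t → there (here (cong (inside ∷_) s≡t))) (∈-allSubsets s))

module _ where

  open import Data.Nat using (_≤_; _<_; s≤s; z≤n)

  -- Definitionally equal to vset on 5-tuples and to the vertex sets occurring in W4.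
  toSubset : Vec (Fin n) m → Subset n
  toSubset []           = ⊥
  toSubset (a ∷ [])     = ⁅ a ⁆
  toSubset (a ∷ b ∷ vs) = ⁅ a ⁆ ∪ toSubset (b ∷ vs)

  toSubset-∷ : (a : Fin n) (vs : Vec (Fin n) m) → toSubset (a ∷ vs) ≡ ⁅ a ⁆ ∪ toSubset vs
  toSubset-∷ a []       = sym (∪-identityʳ ⁅ a ⁆)
  toSubset-∷ a (b ∷ vs) = refl

  toSubset-∷ʳ : (vs : Vec (Fin n) m) (x : Fin n) → toSubset (vs ∷ʳ x) ≡ toSubset vs ∪ ⁅ x ⁆
  toSubset-∷ʳ []       x = sym (∪-identityˡ ⁅ x ⁆)
  toSubset-∷ʳ (a ∷ vs) x = begin
    toSubset (a ∷ (vs ∷ʳ x))       ≡⟨ toSubset-∷ a (vs ∷ʳ x) ⟩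
    ⁅ a ⁆ ∪ toSubset (vs ∷ʳ x)     ≡⟨ cong (⁅ a ⁆ ∪_) (toSubset-∷ʳ vs x) ⟩
    ⁅ a ⁆ ∪ (toSubset vs ∪ ⁅ x ⁆)  ≡⟨ ∪-assoc ⁅ a ⁆ (toSubset vs) ⁅ x ⁆ ⟨
    (⁅ a ⁆ ∪ toSubset vs) ∪ ⁅ x ⁆  ≡⟨ cong (_∪ ⁅ x ⁆) (toSubset-∷ a vs) ⟨
    toSubset (a ∷ vs) ∪ ⁅ x ⁆      ∎
    where open ≡-Reasoning

  ∈-toSubset⁺ : (vs : Vec (Fin n) m) (i : Fin m) → lookup vs i ∈ toSubset vs
  ∈-toSubset⁺ (a ∷ vs) zero    = subst (a ∈_) (sym (toSubset-∷ a vs)) (x∈p∪q⁺ (inj₁ (x∈⁅x⁆ a)))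
  ∈-toSubset⁺ (a ∷ vs) (suc i) = subst (lookup vs i ∈_) (sym (toSubset-∷ a vs)) (x∈p∪q⁺ (inj₂ (∈-toSubset⁺ vs i)))

  ∈-toSubset⁻ : (vs : Vec (Fin n) m) {x : Fin n} → x ∈ toSubset vs → ∃ λ i → lookup vs i ≡ x
  ∈-toSubset⁻ []       x∈⊥ = contradiction x∈⊥ ∉⊥
  ∈-toSubset⁻ (a ∷ vs) {x} x∈ with x∈p∪q⁻ ⁅ a ⁆ (toSubset vs) (subst (x ∈_) (toSubset-∷ a vs) x∈)
  ... | inj₁ x∈⁅a⁆ = zero , sym (x∈⁅y⁆⇒x≡y a x∈⁅a⁆)
  ... | inj₂ x∈vs  = let i , vᵢ≡x = ∈-toSubset⁻ vs x∈vs in suc i , vᵢ≡x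

  ∣toSubset∣≤ : (vs : Vec (Fin n) m) → ∣ toSubset vs ∣ ≤ m
  ∣toSubset∣≤ {n = n} []       = ℕ.≤-reflexive (∣⊥∣≡0 n)
  ∣toSubset∣≤ (a ∷ vs) = begin
    ∣ toSubset (a ∷ vs) ∣       ≡⟨ cong ∣_∣ (trans (toSubset-∷ a vs) (∪-comm ⁅ a ⁆ (toSubset vs))) ⟩
    ∣ toSubset vs ∪ ⁅ a ⁆ ∣     ≤⟨ ∣p∪⁅x⁆∣≤1+∣p∣ (toSubset vs) a ⟩
    suc ∣ toSubset vs ∣         ≤⟨ s≤s (∣toSubset∣≤ vs) ⟩
    suc _                       ∎
    where open ℕ.≤-Reasoning

  ∣toSubset∣≡⇒Unique : (vs : Vec (Fin n) m) → ∣ toSubset vs ∣ ≡ m → Unique vs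
  ∣toSubset∣≡⇒Unique []       _  = []
  ∣toSubset∣≡⇒Unique (a ∷ vs) ∣S∣≡ = All.lookup⁻ (λ i a≡vᵢ → a∉S (subst (_∈ S) (sym a≡vᵢ) (∈-toSubset⁺ vs i)))
                                   ∷ ∣toSubset∣≡⇒Unique vs (ℕ.suc-injective (trans (sym (∣p∪⁅x⁆∣≡1+∣p∣ a∉S)) ∣S∪a∣≡))
    where
    S : Subset _
    S = toSubset vs
    ∣S∪a∣≡ : ∣ S ∪ ⁅ a ⁆ ∣ ≡ suc _
    ∣S∪a∣≡ = trans (cong ∣_∣ (trans (∪-comm S ⁅ a ⁆) (sym (toSubset-∷ a vs)))) ∣S∣≡
    a∉S : a ∉ S
    a∉S a∈S = ℕ.1+n≰n (ℕ.≤-trans (ℕ.≤-reflexive (sym ∣S∪a∣≡))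
                                  (subst (λ s → ∣ s ∣ ≤ _) (sym (p∪⁅x⁆≡p a∈S)) (∣toSubset∣≤ vs)))

module _ where

  open import Data.Rational using (_+_; _*_)
  import Data.Rational.Properties as ℚ

  ∉-toSubset : ∀ {a : Fin n} (vs : Vec (Fin n) m) → All (a ≢_) vs → a ∉ toSubset vs
  ∉-toSubset vs a≢vs a∈vs = let i , vᵢ≡a = ∈-toSubset⁻ vs a∈vs in All.lookup⁺ a≢vs i (sym vᵢ≡a)

  count-toSubset : (vs : Vec (Fin n) m) → Unique vs → (z : Fin n) →
    ∑[ i ← allFin m ] 𝟙 (z ≟ᵇ lookup vs i) ≡ 𝟙 (lookup (toSubset vs) z)
  count-toSubset []                  []              z = cong 𝟙 (sym (Vec.lookup-replicate z outside))
  count-toSubset {m = suc m} (a ∷ vs) (a≢vs ∷ uniq) z = begin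
    ∑[ i ← allFin (suc m) ] 𝟙 (z ≟ᵇ lookup (a ∷ vs) i)     ≡⟨ ∑-allFin-suc m (λ i → 𝟙 (z ≟ᵇ lookup (a ∷ vs) i)) ⟩
    𝟙 (z ≟ᵇ a) + ∑[ i ← allFin m ] 𝟙 (z ≟ᵇ lookup vs i)    ≡⟨ cong (𝟙 (z ≟ᵇ a) +_) (count-toSubset vs uniq z) ⟩
    𝟙 (z ≟ᵇ a) + 𝟙 (lookup (toSubset vs) z)                ≡⟨ 𝟙-disjoint-∨ (z ≟ᵇ a) _ z≡a⇒z∉vs ⟩
    𝟙 ((z ≟ᵇ a) ∨ lookup (toSubset vs) z)                  ≡⟨ cong (λ b → 𝟙 (b ∨ _)) (lookup-⁅⁆ a z) ⟨
    𝟙 (lookup ⁅ a ⁆ z ∨ lookup (toSubset vs) z)            ≡⟨ cong 𝟙 (lookup-∪ ⁅ a ⁆ (toSubset vs) z) ⟨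
    𝟙 (lookup (⁅ a ⁆ ∪ toSubset vs) z)                     ≡⟨ cong (λ s → 𝟙 (lookup s z)) (toSubset-∷ a vs) ⟨
    𝟙 (lookup (toSubset (a ∷ vs)) z)                       ∎
    where
    open ≡-Reasoning
    z≡a⇒z∉vs : z ≟ᵇ a ≡ true → lookup (toSubset vs) z ≡ false
    z≡a⇒z∉vs z≡a rewrite does≡true⇒ (z Fin.≟ a) z≡a = ∉⇒lookup≡false (∉-toSubset vs a≢vs)
    𝟙-disjoint-∨ : ∀ a b → (a ≡ true → b ≡ false) → 𝟙 a + 𝟙 b ≡ 𝟙 (a ∨ b)
    𝟙-disjoint-∨ true  b a⇒¬b rewrite a⇒¬b refl = ℚ.+-identityʳ 1ℚ
    𝟙-disjoint-∨ false b _    = ℚ.+-identityˡ (𝟙 b)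

  ∑-toSubset : (vs : Vec (Fin n) m) → Unique vs → (g : Fin n → ℚ) → (∀ z → z ∉ toSubset vs → g z ≡ 0ℚ) →
    ∑ (allFin n) g ≡ ∑[ i ← allFin m ] g (lookup vs i)
  ∑-toSubset {n} {m} vs uniq g g≡0 = begin
    ∑[ z ← allFin n ] g z                                          ≡⟨ ∑-cong (allFin n) restrict ⟩
    ∑[ z ← allFin n ] (𝟙 (lookup (toSubset vs) z) * g z)           ≡⟨ ∑-cong (allFin n) (λ z → cong (_* g z) (count-toSubset vs uniq z)) ⟨
    ∑[ z ← allFin n ] ((∑[ i ← allFin m ] 𝟙 (z ≟ᵇ lookup vs i)) * g z)
      ≡⟨ ∑-cong (allFin n) (λ z → trans (ℚ.*-comm _ (g z))
                                    (trans (sym (∑-*ˡ (allFin m) (g z) _)) (∑-cong (allFin m) (λ i → ℚ.*-comm (g z) _)))) ⟩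
    ∑[ z ← allFin n ] ∑[ i ← allFin m ] (𝟙 (z ≟ᵇ lookup vs i) * g z) ≡⟨ ∑-comm (allFin n) (allFin m) _ ⟩
    ∑[ i ← allFin m ] ∑[ z ← allFin n ] (𝟙 (z ≟ᵇ lookup vs i) * g z) ≡⟨ ∑-cong (allFin m) (λ i → ∑-δ (lookup vs i) g) ⟩
    ∑[ i ← allFin m ] g (lookup vs i)                              ∎
    where
    open ≡-Reasoning
    restrict : ∀ z → g z ≡ 𝟙 (lookup (toSubset vs) z) * g z
    restrict z with lookup (toSubset vs) z in z∈?vs
    ... | true  = sym (ℚ.*-identityˡ (g z))
    ... | false = trans (g≡0 z (λ z∈vs → contradiction (trans (sym (Vec.[]=⇒lookup z∈vs)) z∈?vs) λ ())) (sym (ℚ.*-zeroˡ (g z)))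

-- Cliques

module _ {n : ℕ} (H : Hypergraph3 n) where

  open import Data.Nat using (_≤_; _<_; _≡ᵇ_; s≤s; z≤n)

  edge-size : ∀ {s} → E H s ≡ true → ∣ s ∣ ≡ 3
  edge-size {s} Es = uniform H s (Equivalence.from Bool.T-≡ Es)

  Complete : Subset n → Set
  Complete s = ∀ {t} → t ⊆ s → ∣ t ∣ ≡ 3 → E H t ≡ true

  IsClique : ℕ → Subset n → Set
  IsClique r s = ∣ s ∣ ≡ r × Complete s

  tripleIsEdgeᵇ : Subset n → Subset n → Bool
  tripleIsEdgeᵇ s t = not ((t ⊆ᵇ s) ∧ (∣ t ∣ ≡ᵇ 3)) ∨ E H t

  isCliqueᵇ⇒IsClique : ∀ {r s} → isCliqueᵇ H r s ≡ true → IsClique r s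
  isCliqueᵇ⇒IsClique {r} {s} eq = ≡ᵇ⇒≡ (proj₁ (∧≡true⁻ eq)) , complete
    where
    complete : Complete s
    complete {t} t⊆s ∣t∣≡3 with allᵇ-sound (tripleIsEdgeᵇ s) (proj₂ (∧≡true⁻ eq)) (∈-allSubsets t)
    ... | holds rewrite ⊆⇒⊆ᵇ t⊆s | ≡⇒≡ᵇ ∣t∣≡3 = holds

  IsClique⇒isCliqueᵇ : ∀ {r s} → IsClique r s → isCliqueᵇ H r s ≡ true
  IsClique⇒isCliqueᵇ {r} {s} (∣s∣≡r , complete) = ∧≡true⁺ (≡⇒≡ᵇ ∣s∣≡r) (allᵇ-complete (tripleIsEdgeᵇ s) (allSubsets n) holds)
    where
    holds : ∀ t → tripleIsEdgeᵇ s t ≡ true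
    holds t with t ⊆ᵇ s in t⊆s | ∣ t ∣ ≡ᵇ 3 in ∣t∣≡3
    ... | false | _     = refl
    ... | true  | false = refl
    ... | true  | true  = complete (⊆ᵇ⇒⊆ t⊆s) (≡ᵇ⇒≡ ∣t∣≡3)

  Complete-⊆ : ∀ {s t} → t ⊆ s → Complete s → Complete t
  Complete-⊆ t⊆s complete u⊆t = complete (⊆-trans u⊆t t⊆s)

  edge⇒Complete : ∀ {s} → E H s ≡ true → Complete s
  edge⇒Complete {s} Es {t} t⊆s ∣t∣≡3 = subst (λ u → E H u ≡ true) (sym t≡s) Es
    where
    t≡s : t ≡ s
    t≡s = ⊆∧∣q∣≤∣p∣⇒≡ t⊆s (ℕ.≤-reflexive (trans (edge-size Es) (sym ∣t∣≡3)))

  Complete-∪⁅⁆ : ∀ {p x} → Complete p → x ∉ p → (∀ {q} → q ⊆ p → ∣ q ∣ ≡ 2 → E H (q ∪ ⁅ x ⁆) ≡ true) →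
    Complete (p ∪ ⁅ x ⁆)
  Complete-∪⁅⁆ {p} {x} complete x∉p extends {t} t⊆p∪x ∣t∣≡3 with x ∈? t
  ... | no  x∉t = complete (⊆-∪⁅⁆⁻ t⊆p∪x x∉t) ∣t∣≡3
  ... | yes x∈t = subst (λ u → E H u ≡ true) (sym t≡t∩p∪x) (extends (p∩q⊆q t p) ∣t∩p∣≡2)
    where
    t≡t∩p∪x : t ≡ (t ∩ p) ∪ ⁅ x ⁆
    t≡t∩p∪x = ⊆-∪⁅⁆-split t⊆p∪x x∈t
    ∣t∩p∣≡2 : ∣ t ∩ p ∣ ≡ 2
    ∣t∩p∣≡2 = ℕ.suc-injective (begin
      suc ∣ t ∩ p ∣          ≡⟨ ∣p∪⁅x⁆∣≡1+∣p∣ (x∉p ∘ p∩q⊆q t p) ⟨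
      ∣ (t ∩ p) ∪ ⁅ x ⁆ ∣    ≡⟨ cong ∣_∣ t≡t∩p∪x ⟨
      ∣ t ∣                  ≡⟨ ∣t∣≡3 ⟩
      3                      ∎)
      where open ≡-Reasoning

  nbhd : Subset n → Subset n
  nbhd p = tabulate (λ v → E H (p ∪ ⁅ v ⁆))

  ∈-nbhd⁻ : ∀ {p x} → x ∈ nbhd p → E H (p ∪ ⁅ x ⁆) ≡ true
  ∈-nbhd⁻ {p} {x} x∈N = trans (sym (Vec.lookup∘tabulate _ x)) (Vec.[]=⇒lookup x∈N)

  ∈-nbhd⁺ : ∀ {p x} → E H (p ∪ ⁅ x ⁆) ≡ true → x ∈ nbhd p
  ∈-nbhd⁺ {p} {x} E = Vec.lookup⇒[]= x (nbhd p) (trans (Vec.lookup∘tabulate _ x) E)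

  deg≡∣nbhd∣ : ∀ p → deg H p ≡ ∣ nbhd p ∣
  deg≡∣nbhd∣ p = count (λ v → E H (p ∪ ⁅ v ⁆)) id
    where
    count : ∀ {m} {A : Set} (f : A → Bool) (g : Fin m → A) →
      length (filter (T? ∘ f) (Data.List.tabulate g)) ≡ ∣ tabulate (f ∘ g) ∣
    count {zero}  f g = refl
    count {suc m} f g with f (g zero)
    ... | true  = cong suc (count f (g ∘ suc))
    ... | false = count f (g ∘ suc)

  numCliques-pos : ∀ {r q s} → IsClique r s → q ⊆ s → 0 < numCliques H r q
  numCliques-pos {r} {q} {s} clique q⊆s =
    0<length-filter _ (∈-allSubsets s) (∧≡true⁺ (IsClique⇒isCliqueᵇ clique) (⊆⇒⊆ᵇ q⊆s))

  deg>0⇒numCliques3>0 : ∀ {p} → 0 < deg H p → 0 < numCliques H 3 p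
  deg>0⇒numCliques3>0 {p} deg>0 = numCliques-pos (edge-size Ep∪z , edge⇒Complete Ep∪z) (p⊆p∪q ⁅ z ⁆)
    where
    z∈N : Nonempty (nbhd p)
    z∈N = ∣p∣>0⇒nonempty (subst (0 <_) (deg≡∣nbhd∣ p) deg>0)
    z : Fin n
    z = proj₁ z∈N
    Ep∪z : E H (p ∪ ⁅ z ⁆) ≡ true
    Ep∪z = ∈-nbhd⁻ (proj₂ z∈N)

  pair-IsClique : ∀ {x y} → x ≢ y → IsClique 2 (⁅ x ⁆ ∪ ⁅ y ⁆)
  pair-IsClique x≢y = ∣⁅x⁆∪⁅y⁆∣≡2 x≢y , λ t⊆p ∣t∣≡3 → contradiction
    (subst₂ _≤_ ∣t∣≡3 (∣⁅x⁆∪⁅y⁆∣≡2 x≢y) (p⊆q⇒∣p∣≤∣q∣ t⊆p)) λ { (s≤s (s≤s ())) }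

  extension⇒IsClique : ∀ {q x} → ∣ q ∣ ℕ.≤ m → IsClique (suc m) (q ∪ ⁅ x ⁆) → IsClique m q × x ∉ q
  extension⇒IsClique {m} {q} {x} ∣q∣≤m (∣q∪x∣≡1+m , complete) = (∣q∣≡m , Complete-⊆ (p⊆p∪q ⁅ x ⁆) complete) , x∉q
    where
    x∉q : x ∉ q
    x∉q x∈q = ℕ.1+n≰n (subst (ℕ._≤ m) (trans (sym (cong ∣_∣ (p∪⁅x⁆≡p x∈q))) ∣q∪x∣≡1+m) ∣q∣≤m)
    ∣q∣≡m : ∣ q ∣ ≡ m
    ∣q∣≡m = ℕ.suc-injective (trans (sym (∣p∪⁅x⁆∣≡1+∣p∣ x∉q)) ∣q∪x∣≡1+m)

module _ {n : ℕ} (H : Hypergraph3 n) where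

  open import Data.Rational using (_+_; _*_)
  import Data.Rational.Properties as ℚ
  open import Data.Nat using (_≡ᵇ_)

  ∑-extensions-nonClique : (vs : Vec (Fin n) m) → ¬ IsClique H m (toSubset vs) →
    ∑[ x ← allFin n ] 𝟙 (isCliqueᵇ H (suc m) (toSubset (vs ∷ʳ x))) ≡ 0ℚ
  ∑-extensions-nonClique {m} vs ¬clique = ∑-zero (allFin n) λ x → 𝟙≡0 _ λ extends →
    ¬clique (proj₁ (extension⇒IsClique H (∣toSubset∣≤ vs)
      (subst (IsClique H (suc m)) (toSubset-∷ʳ vs x) (isCliqueᵇ⇒IsClique H extends))))

  ∑-extensions-clique : (vs : Vec (Fin n) m) → IsClique H m (toSubset vs) →
    ∑[ x ← allFin n ] 𝟙 (isCliqueᵇ H (suc m) (toSubset (vs ∷ʳ x))) ≡ fromℕ (numCliques H (suc m) (toSubset vs))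
  ∑-extensions-clique {m} vs (∣Q∣≡m , _) = begin
    ∑[ x ← allFin n ] 𝟙 (isCliqueᵇ H (suc m) (toSubset (vs ∷ʳ x)))
      ≡⟨ ∑-cong (allFin n) (λ x → cong (𝟙 ∘ clique) (toSubset-∷ʳ vs x)) ⟩
    ∑[ x ← allFin n ] 𝟙 (clique (Q ∪ ⁅ x ⁆))
      ≡⟨ ∑-cong (allFin n) (λ x → 𝟙-absorb (clique (Q ∪ ⁅ x ⁆)) (not (lookup Q x)) (x∉Q x)) ⟩
    ∑[ x ← allFin n ] (𝟙 (not (lookup Q x)) * 𝟙 (clique (Q ∪ ⁅ x ⁆)))
      ≡⟨ ∑-⊇-oneLarger n Q (𝟙 ∘ clique) ⟨
    ∑[ s ← allSubsets n ] (𝟙 ((∣ s ∣ ≡ᵇ suc ∣ Q ∣) ∧ (Q ⊆ᵇ s)) * 𝟙 (clique s))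
      ≡⟨ ∑-cong (allSubsets n) (λ s → 𝟙-restrict (∣ s ∣ ≡ᵇ suc ∣ Q ∣) (Q ⊆ᵇ s) (clique s) (sizeOk s)) ⟩
    ∑[ s ← allSubsets n ] 𝟙 (clique s ∧ (Q ⊆ᵇ s))
      ≡⟨ length-filter (allSubsets n) (λ s → clique s ∧ (Q ⊆ᵇ s)) ⟨
    fromℕ (numCliques H (suc m) Q) ∎
    where
    open ≡-Reasoning
    Q : Subset n
    Q = toSubset vs
    clique : Subset n → Bool
    clique = isCliqueᵇ H (suc m)
    x∉Q : ∀ x → clique (Q ∪ ⁅ x ⁆) ≡ true → not (lookup Q x) ≡ true
    x∉Q x extends = cong not (∉⇒lookup≡false (proj₂ (extension⇒IsClique H (∣toSubset∣≤ vs) (isCliqueᵇ⇒IsClique H extends))))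
    sizeOk : ∀ s → clique s ≡ true → (∣ s ∣ ≡ᵇ suc ∣ Q ∣) ≡ true
    sizeOk s cl = ≡⇒≡ᵇ (trans (proj₁ (isCliqueᵇ⇒IsClique H cl)) (cong suc (sym ∣Q∣≡m)))

  ∑-weightedExtensions : (c : ℚ) (vs : Vec (Fin n) m) →
    (IsClique H m (toSubset vs) → 0 ℕ.< numCliques H (suc m) (toSubset vs)) →
    ∑[ x ← allFin n ] ((c * recip (numCliques H (suc m) (toSubset vs))) * 𝟙 (isCliqueᵇ H (suc m) (toSubset (vs ∷ʳ x))))
      ≡ c * 𝟙 (isCliqueᵇ H m (toSubset vs))
  ∑-weightedExtensions {m} c vs extendable = begin
    ∑[ x ← allFin n ] ((c * r) * 𝟙 (isCliqueᵇ H (suc m) (toSubset (vs ∷ʳ x))))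
      ≡⟨ ∑-*ˡ (allFin n) (c * r) _ ⟩
    (c * r) * ∑[ x ← allFin n ] 𝟙 (isCliqueᵇ H (suc m) (toSubset (vs ∷ʳ x)))
      ≡⟨ byCases (isCliqueᵇ H m Q) refl ⟩
    c * 𝟙 (isCliqueᵇ H m Q) ∎
    where
    open ≡-Reasoning
    Q : Subset n
    Q = toSubset vs
    N : ℕ
    N = numCliques H (suc m) Q
    r : ℚ
    r = recip N
    byCases : ∀ b → isCliqueᵇ H m Q ≡ b → (c * r) * ∑[ x ← allFin n ] 𝟙 (isCliqueᵇ H (suc m) (toSubset (vs ∷ʳ x))) ≡ c * 𝟙 b
    byCases false ¬clique = begin
      (c * r) * _
        ≡⟨ cong ((c * r) *_) (∑-extensions-nonClique vs λ clique →
             contradiction (trans (sym (IsClique⇒isCliqueᵇ H clique)) ¬clique) λ ()) ⟩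
      (c * r) * 0ℚ ≡⟨ ℚ.*-zeroʳ (c * r) ⟩
      0ℚ           ≡⟨ ℚ.*-zeroʳ c ⟨
      c * 0ℚ       ∎
    byCases true clique = begin
      (c * r) * _             ≡⟨ cong ((c * r) *_) (∑-extensions-clique vs (isCliqueᵇ⇒IsClique H clique)) ⟩
      (c * r) * fromℕ N       ≡⟨ ℚ.*-assoc c r (fromℕ N) ⟩
      c * (r * fromℕ N)       ≡⟨ cong (λ t → c * (r * t)) (ℚ.*-identityˡ (fromℕ N)) ⟨
      c * (r * (1ℚ * fromℕ N)) ≡⟨ cong (c *_) (recip-cancel N true (λ _ → extendable (isCliqueᵇ⇒IsClique H clique))) ⟩
      c * 1ℚ                  ∎

-- Extending cliques under the codegree condition

module _ {A : Set} {R : A → A → Set} where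

  AllPairs-lookup : (∀ {x y} → R x y → R y x) → {vs : Vec A m} → AllPairs R vs →
    ∀ {i j} → i ≢ j → R (lookup vs i) (lookup vs j)
  AllPairs-lookup sym (Rx ∷ _)   {zero}  {zero}  0≢0 = contradiction refl 0≢0
  AllPairs-lookup sym (Rx ∷ _)   {zero}  {suc j} _   = All.lookup⁺ Rx j
  AllPairs-lookup sym (Rx ∷ _)   {suc i} {zero}  _   = sym (All.lookup⁺ Rx i)
  AllPairs-lookup sym (_ ∷ Rvs)  {suc i} {suc j} i≢j = AllPairs-lookup sym Rvs (i≢j ∘ cong suc)

  AllPairs-lookup⁻ : {vs : Vec A m} → (∀ {i j} → i ≢ j → R (lookup vs i) (lookup vs j)) → AllPairs R vs
  AllPairs-lookup⁻ {vs = vs} Rᵢⱼ = subst (AllPairs R) (Vec.tabulate∘lookup vs) (AllPairs.tabulate⁺ Rᵢⱼ)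

third : 3 ℕ.≤ m → (i j : Fin m) → ∃ λ k → k ≢ i × k ≢ j
third (ℕ.s≤s (ℕ.s≤s (ℕ.s≤s _))) = choose
  where
  choose : (i j : Fin (3 ℕ.+ _)) → ∃ λ k → k ≢ i × k ≢ j
  choose zero          zero          = suc zero , (λ ()) , (λ ())
  choose zero          (suc zero)    = suc (suc zero) , (λ ()) , (λ ())
  choose zero          (suc (suc _)) = suc zero , (λ ()) , (λ ())
  choose (suc zero)    zero          = suc (suc zero) , (λ ()) , (λ ())
  choose (suc zero)    (suc _)       = zero , (λ ()) , (λ ())
  choose (suc (suc _)) zero          = suc zero , (λ ()) , (λ ())
  choose (suc (suc _)) (suc _)       = zero , (λ ()) , (λ ())

module _ {n : ℕ} where

  open import Data.Nat using (_+_; _*_; _≤_; _<_; s≤s; z≤n)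
  open import Data.Nat.Tactic.RingSolver using (solve-∀)

  -- Large k A says 6 (n − ∣A∣) ≤ k (n − 1): for k = 1 this is 6 ∣A∣ > 5 n, and the
  -- deficits add up when sets are intersected.
  record Large (k : ℕ) (A : Subset n) : Set where
    constructor large
    field bound : 6 * n + k ≤ 6 * ∣ A ∣ + k * n

  ⊤-large : Large 0 ⊤
  ⊤-large = large $ ℕ.≤-reflexive (cong (λ t → 6 * t + 0) (sym (∣⊤∣≡n n)))

  >5n/6⇒large : ∀ {A} → 5 * n < 6 * ∣ A ∣ → Large 1 A
  >5n/6⇒large {A} 5n<6∣A∣ = large $ begin
    6 * n + 1      ≡⟨ rearrange n ⟩
    suc (5 * n) + n ≤⟨ ℕ.+-monoˡ-≤ n 5n<6∣A∣ ⟩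
    6 * ∣ A ∣ + n  ≡⟨ cong (6 * ∣ A ∣ +_) (ℕ.*-identityˡ n) ⟨
    6 * ∣ A ∣ + 1 * n ∎
    where
    open ℕ.≤-Reasoning
    rearrange : ∀ n → 6 * n + 1 ≡ suc (5 * n) + n
    rearrange = solve-∀

  ∩-large : ∀ {a b A B} → Large a A → Large b B → Large (a + b) (A ∩ B)
  ∩-large {a} {b} {A} {B} (large A-large) (large B-large) = large $ ℕ.+-cancelˡ-≤ (6 * n) _ _ (begin
    6 * n + (6 * n + (a + b))                    ≡⟨ split-left (6 * n) a b ⟩
    (6 * n + a) + (6 * n + b)                    ≤⟨ ℕ.+-mono-≤ A-large B-large ⟩
    (6 * ∣ A ∣ + a * n) + (6 * ∣ B ∣ + b * n)    ≡⟨ split-right ∣ A ∣ ∣ B ∣ a b n ⟩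
    6 * (∣ A ∣ + ∣ B ∣) + (a + b) * n            ≤⟨ ℕ.+-monoˡ-≤ ((a + b) * n) (ℕ.*-monoʳ-≤ 6 (∣p∣+∣q∣≤∣p∩q∣+n A B)) ⟩
    6 * (∣ A ∩ B ∣ + n) + (a + b) * n            ≡⟨ regroup ∣ A ∩ B ∣ n a b ⟩
    6 * n + (6 * ∣ A ∩ B ∣ + (a + b) * n)        ∎)
    where
    open ℕ.≤-Reasoning
    split-left : ∀ m a b → m + (m + (a + b)) ≡ (m + a) + (m + b)
    split-left = solve-∀
    split-right : ∀ x y a b n → (6 * x + a * n) + (6 * y + b * n) ≡ 6 * (x + y) + (a + b) * n
    split-right = solve-∀
    regroup : ∀ c n a b → 6 * (c + n) + (a + b) * n ≡ 6 * n + (6 * c + (a + b) * n)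
    regroup = solve-∀

  large⇒nonempty : ∀ {k A} → 1 ≤ k → k ≤ 6 → Large k A → Nonempty A
  large⇒nonempty {k} {A} 1≤k k≤6 (large A-large) = ∣p∣>0⇒nonempty (ℕ.n≢0⇒n>0 ∣A∣≢0)
    where
    ∣A∣≢0 : ∣ A ∣ ≢ 0
    ∣A∣≢0 ∣A∣≡0 = ℕ.<⇒≱ 1≤k (ℕ.+-cancelˡ-≤ (6 * n) k 0 (begin
      6 * n + k        ≤⟨ A-large ⟩
      6 * ∣ A ∣ + k * n ≡⟨ cong (λ a → 6 * a + k * n) ∣A∣≡0 ⟩
      k * n            ≤⟨ ℕ.*-monoˡ-≤ n k≤6 ⟩
      6 * n            ≡⟨ ℕ.+-identityʳ (6 * n) ⟨
      6 * n + 0        ∎))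
      where open ℕ.≤-Reasoning

module _ {n : ℕ} (H : Hypergraph3 n) where

  open import Data.Nat using (_+_; _*_; _≤_; _<_; s≤s; z≤n)
  open import Data.Nat.Combinatorics using (_C_; nC1≡n; nCk+nC[k+1]≡[n+1]C[k+1])

  Codegree>5n/6 : Set
  Codegree>5n/6 = (p : Subset n) → ∣ p ∣ ≡ 2 → 0 < deg H p → 5 * n < 6 * deg H p

  commonNbhdWith : Fin n → Vec (Fin n) m → Subset n
  commonNbhdWith a []       = ⊤
  commonNbhdWith a (v ∷ vs) = nbhd H (⁅ a ⁆ ∪ ⁅ v ⁆) ∩ commonNbhdWith a vs

  commonNbhd : Vec (Fin n) m → Subset n
  commonNbhd []       = ⊤
  commonNbhd (a ∷ vs) = commonNbhdWith a vs ∩ commonNbhd vs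

  LargePairNbhd : Fin n → Fin n → Set
  LargePairNbhd a v = Large 1 (nbhd H (⁅ a ⁆ ∪ ⁅ v ⁆))

  commonNbhdWith-large : ∀ {a} (vs : Vec (Fin n) m) → All (LargePairNbhd a) vs → Large m (commonNbhdWith a vs)
  commonNbhdWith-large []       []                = ⊤-large
  commonNbhdWith-large (v ∷ vs) (av-large ∷ avs-large) = ∩-large av-large (commonNbhdWith-large vs avs-large)

  commonNbhd-large : (vs : Vec (Fin n) m) → AllPairs LargePairNbhd vs → Large (m C 2) (commonNbhd vs)
  commonNbhd-large []           []                 = ⊤-large
  commonNbhd-large {suc m} (a ∷ vs) (avs-large ∷ vs-large) =
    subst (λ k → Large k (commonNbhd (a ∷ vs))) pascal
      (∩-large (commonNbhdWith-large vs avs-large) (commonNbhd-large vs vs-large))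
    where
    pascal : m + m C 2 ≡ suc m C 2
    pascal = trans (cong (_+ m C 2) (sym (nC1≡n m))) (nCk+nC[k+1]≡[n+1]C[k+1] m 1)

  ∈-commonNbhdWith⁻ : ∀ {a x} (vs : Vec (Fin n) m) → x ∈ commonNbhdWith a vs →
    All (λ v → E H ((⁅ a ⁆ ∪ ⁅ v ⁆) ∪ ⁅ x ⁆) ≡ true) vs
  ∈-commonNbhdWith⁻ []       _  = []
  ∈-commonNbhdWith⁻ (v ∷ vs) x∈ = let x∈N , x∈rest = x∈p∩q⁻ _ _ x∈ in ∈-nbhd⁻ H x∈N ∷ ∈-commonNbhdWith⁻ vs x∈rest

  ∈-commonNbhd⁻ : ∀ {x} (vs : Vec (Fin n) m) → x ∈ commonNbhd vs →
    AllPairs (λ a v → E H ((⁅ a ⁆ ∪ ⁅ v ⁆) ∪ ⁅ x ⁆) ≡ true) vs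
  ∈-commonNbhd⁻ []       _  = []
  ∈-commonNbhd⁻ (a ∷ vs) x∈ = let x∈N , x∈rest = x∈p∩q⁻ _ _ x∈ in ∈-commonNbhdWith⁻ vs x∈N ∷ ∈-commonNbhd⁻ vs x∈rest

  pairCount-bounds : 3 ≤ m → m ≤ 4 → 1 ≤ m C 2 × m C 2 ≤ 6
  pairCount-bounds {m = 3} _ _ = s≤s z≤n , s≤s (s≤s (s≤s z≤n))
  pairCount-bounds {m = 4} _ _ = s≤s z≤n , ℕ.≤-refl
  pairCount-bounds {m = 1} (s≤s ()) _
  pairCount-bounds {m = 2} (s≤s (s≤s ())) _
  pairCount-bounds {m = suc (suc (suc (suc (suc _))))} _ (s≤s (s≤s (s≤s (s≤s ()))))

  module _ (vs : Vec (Fin n) m) (3≤m : 3 ≤ m) (clique : IsClique H m (toSubset vs)) where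

    private
      Q : Subset n
      Q = toSubset vs
      v : Fin m → Fin n
      v = lookup vs

      lookup-inj : ∀ i j → v i ≡ v j → i ≡ j
      lookup-inj = lookup-injective (∣toSubset∣≡⇒Unique vs (proj₁ clique))

    pair-in-shadow : ∀ {i j} → i ≢ j → 0 < deg H (⁅ v i ⁆ ∪ ⁅ v j ⁆)
    pair-in-shadow {i} {j} i≢j = subst (0 <_) (sym (deg≡∣nbhd∣ H _)) (x∈p⇒0<∣p∣ (∈-nbhd⁺ H triple-edge))
      where
      k : Fin m
      k = proj₁ (third 3≤m i j)
      triple-edge : E H ((⁅ v i ⁆ ∪ ⁅ v j ⁆) ∪ ⁅ v k ⁆) ≡ true
      triple-edge = proj₂ clique
        (∪⊆ (∪⊆ (⁅x⁆⊆ (∈-toSubset⁺ vs i)) (⁅x⁆⊆ (∈-toSubset⁺ vs j))) (⁅x⁆⊆ (∈-toSubset⁺ vs k)))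
        (trans (∣p∪⁅x⁆∣≡1+∣p∣ vₖ∉) (cong suc (∣⁅x⁆∪⁅y⁆∣≡2 (i≢j ∘ lookup-inj i j))))
        where
        vₖ∉ : v k ∉ ⁅ v i ⁆ ∪ ⁅ v j ⁆
        vₖ∉ vₖ∈ = [ proj₁ (proj₂ (third 3≤m i j)) ∘ lookup-inj k i ∘ x∈⁅y⁆⇒x≡y (v i)
                  , proj₂ (proj₂ (third 3≤m i j)) ∘ lookup-inj k j ∘ x∈⁅y⁆⇒x≡y (v j) ] (x∈p∪q⁻ _ _ vₖ∈)

    cliques-extend : Codegree>5n/6 → m ≤ 4 → 0 < numCliques H (suc m) Q
    cliques-extend codegree m≤4 = numCliques-pos H (∣Q∪x∣≡1+m , Complete-∪⁅⁆ H (proj₂ clique) x∉Q extends) (p⊆p∪q ⁅ x ⁆)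
      where
      pairs-large : AllPairs LargePairNbhd vs
      pairs-large = AllPairs-lookup⁻ λ {i} {j} i≢j →
        >5n/6⇒large (subst (5 * n <_) (cong (6 *_) (deg≡∣nbhd∣ H _))
          (codegree _ (∣⁅x⁆∪⁅y⁆∣≡2 (i≢j ∘ lookup-inj i j)) (pair-in-shadow i≢j)))
      common-nonempty : Nonempty (commonNbhd vs)
      common-nonempty = let 1≤C , C≤6 = pairCount-bounds 3≤m m≤4 in
        large⇒nonempty 1≤C C≤6 (commonNbhd-large vs pairs-large)
      x : Fin n
      x = proj₁ common-nonempty
      edgeWithPair : ∀ {i j} → i ≢ j → E H ((⁅ v i ⁆ ∪ ⁅ v j ⁆) ∪ ⁅ x ⁆) ≡ true
      edgeWithPair = AllPairs-lookup (λ {a} {b} → subst (λ p → E H (p ∪ ⁅ x ⁆) ≡ true) (∪-comm ⁅ a ⁆ ⁅ b ⁆))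
                (∈-commonNbhd⁻ vs (proj₂ common-nonempty))
      x∉Q : x ∉ Q
      x∉Q x∈Q with ∈-toSubset⁻ vs x∈Q
      ... | i , vᵢ≡x with third 3≤m i i
      ...   | j , j≢i , _ = 2≢3 (begin
        2                                ≡⟨ ∣⁅x⁆∪⁅y⁆∣≡2 (j≢i ∘ lookup-inj j i) ⟨
        ∣ ⁅ v j ⁆ ∪ ⁅ v i ⁆ ∣
          ≡⟨ cong ∣_∣ (p∪⁅x⁆≡p {p = ⁅ v j ⁆ ∪ ⁅ v i ⁆} (x∈p∪q⁺ (inj₂ (subst (_∈ ⁅ v i ⁆) vᵢ≡x (x∈⁅x⁆ (v i)))))) ⟨
        ∣ (⁅ v j ⁆ ∪ ⁅ v i ⁆) ∪ ⁅ x ⁆ ∣  ≡⟨ edge-size H (edgeWithPair j≢i) ⟩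
        3                                ∎)
        where
        open ≡-Reasoning
        2≢3 : 2 ≢ 3
        2≢3 ()
      extends : ∀ {q} → q ⊆ Q → ∣ q ∣ ≡ 2 → E H (q ∪ ⁅ x ⁆) ≡ true
      extends {q} q⊆Q ∣q∣≡2 with ∣p∣≡2⇒pair {p = q} ∣q∣≡2
      ... | y , z , y≢z , refl
        with ∈-toSubset⁻ vs (q⊆Q (x∈p∪q⁺ (inj₁ (x∈⁅x⁆ y)))) | ∈-toSubset⁻ vs (q⊆Q (x∈p∪q⁺ (inj₂ (x∈⁅x⁆ z))))
      ...   | i , refl | j , refl = edgeWithPair (y≢z ∘ cong v)
      ∣Q∪x∣≡1+m : ∣ Q ∪ ⁅ x ⁆ ∣ ≡ suc m
      ∣Q∪x∣≡1+m = trans (∣p∪⁅x⁆∣≡1+∣p∣ x∉Q) (cong suc (proj₁ clique))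

-- The weights ψ_K

module _ where

  open import Data.Rational using (_+_; _*_; -_; _/_)
  import Data.Integer as ℤ

  ψval : ℕ → ℚ
  ψval k = if k ℕ.≡ᵇ 1 then - (ℤ.+ 1 / 6) else ℤ.+ 1 / 3

  inAB : Fin 5 → Bool
  inAB k = (k ≟ᵇ zero) ∨ (k ≟ᵇ suc zero)

  -- ψ_K of the triple of vertices of K at positions i, j, k, or 0 when k ∈ {i, j}.
  ψTable : Fin 5 → Fin 5 → Fin 5 → ℚ
  ψTable i j k = 𝟙 (not ((k ≟ᵇ i) ∨ (k ≟ᵇ j))) * ψval (𝟙ℕ (inAB k) ℕ.+ (𝟙ℕ (inAB j) ℕ.+ 𝟙ℕ (inAB i)))

  ∑-ψTable : ∀ i j → i ≢ j →
    ∑[ k ← allFin 5 ] ψTable i j k ≡ 𝟙 ((zero ≟ᵇ i) ∧ (suc zero ≟ᵇ j)) + 𝟙 ((zero ≟ᵇ j) ∧ (suc zero ≟ᵇ i))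
  ∑-ψTable zero                         zero                         0≢0 = contradiction refl 0≢0
  ∑-ψTable zero                         (suc zero)                   _   = refl
  ∑-ψTable zero                         (suc (suc zero))             _   = refl
  ∑-ψTable zero                         (suc (suc (suc zero)))       _   = refl
  ∑-ψTable zero                         (suc (suc (suc (suc zero)))) _   = refl
  ∑-ψTable (suc zero)                   zero                         _   = refl
  ∑-ψTable (suc zero)                   (suc zero)                   1≢1 = contradiction refl 1≢1
  ∑-ψTable (suc zero)                   (suc (suc zero))             _   = refl
  ∑-ψTable (suc zero)                   (suc (suc (suc zero)))       _   = refl
  ∑-ψTable (suc zero)                   (suc (suc (suc (suc zero)))) _   = refl
  ∑-ψTable (suc (suc zero))             zero                         _   = refl
  ∑-ψTable (suc (suc zero))             (suc zero)                   _   = refl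
  ∑-ψTable (suc (suc zero))             (suc (suc zero))             2≢2 = contradiction refl 2≢2
  ∑-ψTable (suc (suc zero))             (suc (suc (suc zero)))       _   = refl
  ∑-ψTable (suc (suc zero))             (suc (suc (suc (suc zero)))) _   = refl
  ∑-ψTable (suc (suc (suc zero)))       zero                         _   = refl
  ∑-ψTable (suc (suc (suc zero)))       (suc zero)                   _   = refl
  ∑-ψTable (suc (suc (suc zero)))       (suc (suc zero))             _   = refl
  ∑-ψTable (suc (suc (suc zero)))       (suc (suc (suc zero)))       3≢3 = contradiction refl 3≢3
  ∑-ψTable (suc (suc (suc zero)))       (suc (suc (suc (suc zero)))) _   = refl
  ∑-ψTable (suc (suc (suc (suc zero)))) zero                         _   = refl
  ∑-ψTable (suc (suc (suc (suc zero)))) (suc zero)                   _   = refl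
  ∑-ψTable (suc (suc (suc (suc zero)))) (suc (suc zero))             _   = refl
  ∑-ψTable (suc (suc (suc (suc zero)))) (suc (suc (suc zero)))       _   = refl
  ∑-ψTable (suc (suc (suc (suc zero)))) (suc (suc (suc (suc zero)))) 4≢4 = contradiction refl 4≢4

module _ {n : ℕ} (H : Hypergraph3 n) where

  open import Data.Rational using (_+_; _*_)
  import Data.Rational.Properties as ℚ
  open import Data.Nat using (_≡ᵇ_)

  ∑-edges⊇pair : ∀ {P : Subset n} → ∣ P ∣ ≡ 2 → (f : Subset n → ℚ) →
    ∑[ e ← allSubsets n ] (𝟙 (E H e) * (𝟙 (P ⊆ᵇ e) * f e))
      ≡ ∑[ z ← allFin n ] (𝟙 (not (lookup P z)) * (𝟙 (E H (P ∪ ⁅ z ⁆)) * f (P ∪ ⁅ z ⁆)))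
  ∑-edges⊇pair {P} ∣P∣≡2 f = trans
    (∑-cong (allSubsets n) λ e → edgesHaveSize3 (E H e) (∣ e ∣ ≡ᵇ suc ∣ P ∣) (P ⊆ᵇ e) (f e)
      (λ Ee → ≡⇒≡ᵇ (trans (edge-size H Ee) (cong suc (sym ∣P∣≡2)))))
    (∑-⊇-oneLarger n P (λ e → 𝟙 (E H e) * f e))
    where
    edgesHaveSize3 : ∀ a c b x → (a ≡ true → c ≡ true) → 𝟙 a * (𝟙 b * x) ≡ 𝟙 (c ∧ b) * (𝟙 a * x)
    edgesHaveSize3 false c b x _ = trans (ℚ.*-zeroˡ (𝟙 b * x)) (sym (trans (cong (𝟙 (c ∧ b) *_) (ℚ.*-zeroˡ x)) (ℚ.*-zeroʳ (𝟙 (c ∧ b)))))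
    edgesHaveSize3 true  c b x a⇒c rewrite a⇒c refl = trans (ℚ.*-identityˡ (𝟙 b * x)) (cong (𝟙 b *_) (sym (ℚ.*-identityˡ x)))

  ψ-outside : (K : Vec (Fin n) 5) {e : Subset n} → ¬ (e ⊆ vset H K) → ψ H K e ≡ 0ℚ
  ψ-outside K@(_ ∷ _ ∷ _ ∷ _ ∷ _ ∷ []) {e} e⊈V rewrite dec-false (e ⊆? vset H K) e⊈V | Bool.∧-zeroʳ (E H e) = refl

  ψ-inside : (K : Vec (Fin n) 5) {e : Subset n} → e ⊆ vset H K → E H e ≡ true →
    ψ H K e ≡ ψval ∣ e ∩ (⁅ lookup K zero ⁆ ∪ ⁅ lookup K (suc zero) ⁆) ∣
  ψ-inside K@(_ ∷ _ ∷ _ ∷ _ ∷ _ ∷ []) {e} e⊆V Ee rewrite Ee | ⊆⇒⊆ᵇ e⊆V = refl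

  module _ (a b c d f : Fin n) (clique : IsClique H 5 (toSubset (a ∷ b ∷ c ∷ d ∷ f ∷ []))) where

    private
      K : Vec (Fin n) 5
      K = a ∷ b ∷ c ∷ d ∷ f ∷ []
      V : Subset n
      V = toSubset K
      ι : Fin 5 → Fin n
      ι = lookup K

      ι-inj : ∀ i j → ι i ≡ ι j → i ≡ j
      ι-inj = lookup-injective (∣toSubset∣≡⇒Unique K (proj₁ clique))

      ≟ᵇ-ι : ∀ k i → ι k ≟ᵇ ι i ≡ k ≟ᵇ i
      ≟ᵇ-ι = ≟ᵇ-injective ι-inj

      lookup-ab : ∀ k → lookup (⁅ a ⁆ ∪ ⁅ b ⁆) (ι k) ≡ inAB k
      lookup-ab k = trans (lookup-∪ ⁅ a ⁆ ⁅ b ⁆ (ι k))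
        (cong₂ _∨_ (trans (lookup-⁅⁆ a (ι k)) (≟ᵇ-ι k zero)) (trans (lookup-⁅⁆ b (ι k)) (≟ᵇ-ι k (suc zero))))

      summand : Subset n → Fin n → ℚ
      summand P z = 𝟙 (not (lookup P z)) * (𝟙 (E H (P ∪ ⁅ z ⁆)) * ψ H K (P ∪ ⁅ z ⁆))

      summand-outside : ∀ {P z} → ¬ (P ∪ ⁅ z ⁆ ⊆ V) → summand P z ≡ 0ℚ
      summand-outside {P} {z} P∪z⊈V = begin
        summand P z
          ≡⟨ cong (λ t → 𝟙 (not (lookup P z)) * (𝟙 (E H (P ∪ ⁅ z ⁆)) * t)) (ψ-outside K P∪z⊈V) ⟩
        𝟙 (not (lookup P z)) * (𝟙 (E H (P ∪ ⁅ z ⁆)) * 0ℚ)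
          ≡⟨ cong (𝟙 (not (lookup P z)) *_) (ℚ.*-zeroʳ (𝟙 (E H (P ∪ ⁅ z ⁆)))) ⟩
        𝟙 (not (lookup P z)) * 0ℚ                         ≡⟨ ℚ.*-zeroʳ (𝟙 (not (lookup P z))) ⟩
        0ℚ                                                ∎
        where open ≡-Reasoning

      summand≡ψTable : ∀ {i j} → i ≢ j → ∀ k → summand (⁅ ι i ⁆ ∪ ⁅ ι j ⁆) (ι k) ≡ ψTable i j k
      summand≡ψTable {i} {j} i≢j k =
        trans (cong (λ b → 𝟙 (not b) * value) lookup-P) (byCases ((k ≟ᵇ i) ∨ (k ≟ᵇ j)) refl)
        where
        P e : Subset n
        P = ⁅ ι i ⁆ ∪ ⁅ ι j ⁆
        e = P ∪ ⁅ ι k ⁆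
        value : ℚ
        value = 𝟙 (E H e) * ψ H K e
        count : ℕ
        count = 𝟙ℕ (inAB k) ℕ.+ (𝟙ℕ (inAB j) ℕ.+ 𝟙ℕ (inAB i))
        lookup-P : lookup P (ι k) ≡ (k ≟ᵇ i) ∨ (k ≟ᵇ j)
        lookup-P = trans (lookup-∪ ⁅ ι i ⁆ ⁅ ι j ⁆ (ι k))
          (cong₂ _∨_ (trans (lookup-⁅⁆ (ι i) (ι k)) (≟ᵇ-ι k i)) (trans (lookup-⁅⁆ (ι j) (ι k)) (≟ᵇ-ι k j)))
        value≡ : ι k ∉ P → value ≡ ψval count
        value≡ ιk∉P = begin
          𝟙 (E H e) * ψ H K e                  ≡⟨ cong₂ (λ b t → 𝟙 b * t) Ee (ψ-inside K e⊆V Ee) ⟩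
          1ℚ * ψval ∣ e ∩ (⁅ a ⁆ ∪ ⁅ b ⁆) ∣    ≡⟨ ℚ.*-identityˡ (ψval ∣ e ∩ (⁅ a ⁆ ∪ ⁅ b ⁆) ∣) ⟩
          ψval ∣ e ∩ (⁅ a ⁆ ∪ ⁅ b ⁆) ∣         ≡⟨ cong ψval ∣e∩ab∣ ⟩
          ψval count                           ∎
          where
          open ≡-Reasoning
          ιj∉⁅ιi⁆ : ι j ∉ ⁅ ι i ⁆
          ιj∉⁅ιi⁆ = x≢y⇒x∉⁅y⁆ (i≢j ∘ sym ∘ ι-inj j i)
          e⊆V : e ⊆ V
          e⊆V = ∪⊆ (∪⊆ (⁅x⁆⊆ (∈-toSubset⁺ K i)) (⁅x⁆⊆ (∈-toSubset⁺ K j))) (⁅x⁆⊆ (∈-toSubset⁺ K k))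
          Ee : E H e ≡ true
          Ee = proj₂ clique e⊆V (trans (∣p∪⁅x⁆∣≡1+∣p∣ ιk∉P) (cong suc (∣⁅x⁆∪⁅y⁆∣≡2 (i≢j ∘ ι-inj i j))))
          ∣e∩ab∣ : ∣ e ∩ (⁅ a ⁆ ∪ ⁅ b ⁆) ∣ ≡ count
          ∣e∩ab∣ = begin
            ∣ e ∩ (⁅ a ⁆ ∪ ⁅ b ⁆) ∣ ≡⟨ ∣p∪⁅x⁆∩q∣ (⁅ a ⁆ ∪ ⁅ b ⁆) ιk∉P ⟩
            𝟙ℕ (lookup (⁅ a ⁆ ∪ ⁅ b ⁆) (ι k)) ℕ.+ ∣ P ∩ (⁅ a ⁆ ∪ ⁅ b ⁆) ∣
              ≡⟨ cong (𝟙ℕ (lookup (⁅ a ⁆ ∪ ⁅ b ⁆) (ι k)) ℕ.+_) (∣p∪⁅x⁆∩q∣ (⁅ a ⁆ ∪ ⁅ b ⁆) ιj∉⁅ιi⁆) ⟩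
            𝟙ℕ (lookup (⁅ a ⁆ ∪ ⁅ b ⁆) (ι k)) ℕ.+ (𝟙ℕ (lookup (⁅ a ⁆ ∪ ⁅ b ⁆) (ι j)) ℕ.+ ∣ ⁅ ι i ⁆ ∩ (⁅ a ⁆ ∪ ⁅ b ⁆) ∣)
              ≡⟨ cong₂ ℕ._+_ (cong 𝟙ℕ (lookup-ab k)) (cong₂ ℕ._+_ (cong 𝟙ℕ (lookup-ab j)) (trans (∣⁅x⁆∩q∣ (ι i) (⁅ a ⁆ ∪ ⁅ b ⁆)) (cong 𝟙ℕ (lookup-ab i)))) ⟩
            count ∎
        byCases : ∀ b → (k ≟ᵇ i) ∨ (k ≟ᵇ j) ≡ b → 𝟙 (not b) * value ≡ 𝟙 (not b) * ψval count
        byCases true  _        = trans (ℚ.*-zeroˡ value) (sym (ℚ.*-zeroˡ (ψval count)))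
        byCases false k≢i∧k≢j = cong (1ℚ *_) (value≡ λ ιk∈P →
          contradiction (trans (sym (Vec.[]=⇒lookup ιk∈P)) (trans lookup-P k≢i∧k≢j)) λ ())

    ∑ψ-pair : ∀ {u v} → u ≢ v →
      ∑[ e ← allSubsets n ] (𝟙 (E H e) * (𝟙 ((⁅ u ⁆ ∪ ⁅ v ⁆) ⊆ᵇ e) * ψ H K e))
        ≡ 𝟙 ((a ≟ᵇ u) ∧ (b ≟ᵇ v)) + 𝟙 ((a ≟ᵇ v) ∧ (b ≟ᵇ u))
    ∑ψ-pair {u} {v} u≢v =
      trans (∑-edges⊇pair {P = ⁅ u ⁆ ∪ ⁅ v ⁆} (∣⁅x⁆∪⁅y⁆∣≡2 u≢v) (ψ H K)) (byMembership (u ∈? V) (v ∈? V))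
      where
      P : Subset n
      P = ⁅ u ⁆ ∪ ⁅ v ⁆
      RHS : ℚ
      RHS = 𝟙 ((a ≟ᵇ u) ∧ (b ≟ᵇ v)) + 𝟙 ((a ≟ᵇ v) ∧ (b ≟ᵇ u))
      ∉V : ∀ {x y} → y ∈ V → x ∉ V → y ≟ᵇ x ≡ false
      ∉V {x} {y} y∈V x∉V = dec-false (y Fin.≟ x) λ y≡x → x∉V (subst (_∈ V) y≡x y∈V)
      a∈V : a ∈ V
      a∈V = ∈-toSubset⁺ K zero
      b∈V : b ∈ V
      b∈V = ∈-toSubset⁺ K (suc zero)
      no-summands : ∀ {x} → x ∈ P → x ∉ V → ∑ (allFin n) (summand P) ≡ 0ℚ
      no-summands x∈P x∉V = ∑-zero (allFin n) λ z → summand-outside {P} λ P∪z⊆V → x∉V (P∪z⊆V (x∈p∪q⁺ (inj₁ x∈P)))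
      byMembership : Dec (u ∈ V) → Dec (v ∈ V) →
        ∑ (allFin n) (summand P) ≡ 𝟙 ((a ≟ᵇ u) ∧ (b ≟ᵇ v)) + 𝟙 ((a ≟ᵇ v) ∧ (b ≟ᵇ u))
      byMembership (no u∉V) _ rewrite ∉V a∈V u∉V | ∉V b∈V u∉V | Bool.∧-zeroʳ (a ≟ᵇ v) =
        no-summands (x∈p∪q⁺ (inj₁ (x∈⁅x⁆ u))) u∉V
      byMembership (yes _) (no v∉V) rewrite ∉V a∈V v∉V | ∉V b∈V v∉V | Bool.∧-zeroʳ (a ≟ᵇ u) =
        no-summands (x∈p∪q⁺ (inj₂ (x∈⁅x⁆ v))) v∉V
      byMembership (yes u∈V) (yes v∈V) with ∈-toSubset⁻ K u∈V | ∈-toSubset⁻ K v∈V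
      ... | i , refl | j , refl = begin
        ∑[ z ← allFin n ] summand P z      ≡⟨ ∑-toSubset K (∣toSubset∣≡⇒Unique K (proj₁ clique)) (summand P) (λ z z∉V →
                                             summand-outside {P} λ P∪z⊆V → z∉V (P∪z⊆V (x∈p∪q⁺ (inj₂ (x∈⁅x⁆ z))))) ⟩
        ∑[ k ← allFin 5 ] summand P (ι k)  ≡⟨ ∑-cong (allFin 5) (summand≡ψTable i≢j) ⟩
        ∑[ k ← allFin 5 ] ψTable i j k     ≡⟨ ∑-ψTable i j i≢j ⟩
        𝟙 ((zero ≟ᵇ i) ∧ (suc zero ≟ᵇ j)) + 𝟙 ((zero ≟ᵇ j) ∧ (suc zero ≟ᵇ i))
          ≡⟨ cong₂ (λ s t → 𝟙 s + 𝟙 t) (cong₂ _∧_ (≟ᵇ-ι zero i) (≟ᵇ-ι (suc zero) j))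
                                        (cong₂ _∧_ (≟ᵇ-ι zero j) (≟ᵇ-ι (suc zero) i)) ⟨
        RHS ∎
        where
        open ≡-Reasoning
        i≢j : i ≢ j
        i≢j = u≢v ∘ cong ι

-- The weighting w_H

module _ {n : ℕ} (H : Hypergraph3 n) where

  open import Data.Rational using (_+_; _*_; _/_)
  import Data.Rational.Properties as ℚ
  open import Data.Rational.Solver using (module +-*-Solver)
  open +-*-Solver using (solve; _:*_; _:=_)
  import Data.Integer as ℤ

  ½ : ℚ
  ½ = ℤ.+ 1 / 2

  weight : Vec (Fin n) 5 → ℚ
  weight K = W4 H (lookup K zero) (lookup K (suc zero)) (lookup K (suc (suc zero))) (lookup K (suc (suc (suc zero))))

  clique5ᵇ : Vec (Fin n) 5 → Bool
  clique5ᵇ K = isCliqueᵇ H 5 (vset H K)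

  clique⇒distinct : (K : Vec (Fin n) 5) → clique5ᵇ K ≡ true → distinctᵇ H K ≡ true
  clique⇒distinct K@(_ ∷ _ ∷ _ ∷ _ ∷ _ ∷ []) clique =
    ∧≡true⁺ (≢ (# 0) (# 1) λ ()) $ ∧≡true⁺ (≢ (# 0) (# 2) λ ()) $ ∧≡true⁺ (≢ (# 0) (# 3) λ ()) $
    ∧≡true⁺ (≢ (# 0) (# 4) λ ()) $ ∧≡true⁺ (≢ (# 1) (# 2) λ ()) $ ∧≡true⁺ (≢ (# 1) (# 3) λ ()) $
    ∧≡true⁺ (≢ (# 1) (# 4) λ ()) $ ∧≡true⁺ (≢ (# 2) (# 3) λ ()) $ ∧≡true⁺ (≢ (# 2) (# 4) λ ()) $
    ≢ (# 3) (# 4) λ ()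
    where
    ≢ : ∀ i j → i ≢ j → neqᵇ H (lookup K i) (lookup K j) ≡ true
    ≢ i j i≢j = cong not (dec-false (lookup K i Fin.≟ lookup K j)
      (i≢j ∘ lookup-injective (∣toSubset∣≡⇒Unique K (proj₁ (isCliqueᵇ⇒IsClique H clique))) i j))

  w≡ : ∀ e → w H e ≡ ½ * ∑[ K ← tuples5 H ] (𝟙 (clique5ᵇ K) * (weight K * ψ H K e))
  w≡ e = cong (½ *_) (trans
    (∑-filter (tuples5 H) (λ K → distinctᵇ H K ∧ clique5ᵇ K ∧ (e ⊆ᵇ vset H K)) (λ K → weight K * ψ H K e))
    (∑-cong (tuples5 H) λ K → onlyCliquesCount (distinctᵇ H K) (clique5ᵇ K) (e ⊆ᵇ vset H K) (weight K * ψ H K e)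
      (clique⇒distinct K) (ψ-vanishes K)))
    where
    onlyCliquesCount : ∀ d c s x → (c ≡ true → d ≡ true) → (s ≡ false → x ≡ 0ℚ) → 𝟙 (d ∧ (c ∧ s)) * x ≡ 𝟙 c * x
    onlyCliquesCount d false s     x _   _   rewrite Bool.∧-zeroʳ d = refl
    onlyCliquesCount d true  true  x c⇒d _   rewrite c⇒d refl = refl
    onlyCliquesCount d true  false x c⇒d s⇒0 rewrite c⇒d refl | s⇒0 refl = refl
    ψ-vanishes : ∀ K → e ⊆ᵇ vset H K ≡ false → weight K * ψ H K e ≡ 0ℚ
    ψ-vanishes K e⊈V = trans (cong (weight K *_) (ψ-outside H K λ e⊆V → contradiction (trans (sym (⊆⇒⊆ᵇ e⊆V)) e⊈V) λ ()))
                             (ℚ.*-zeroʳ (weight K))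

  ∑ψ : Subset n → Vec (Fin n) 5 → ℚ
  ∑ψ P K = ∑[ e ← allSubsets n ] (𝟙 (E H e) * (𝟙 (P ⊆ᵇ e) * ψ H K e))

  degw≡ : ∀ P → degw H P ≡ ½ * ∑[ K ← tuples5 H ] (𝟙 (clique5ᵇ K) * (weight K * ∑ψ P K))
  degw≡ P = begin
    degw H P                                                   ≡⟨ ∑-filter (edges H) (P ⊆ᵇ_) (w H) ⟩
    ∑[ e ← edges H ] (𝟙 (P ⊆ᵇ e) * w H e)                      ≡⟨ ∑-filter (allSubsets n) (E H) (λ e → 𝟙 (P ⊆ᵇ e) * w H e) ⟩
    ∑[ e ← allSubsets n ] (𝟙 (E H e) * (𝟙 (P ⊆ᵇ e) * w H e))  ≡⟨ ∑-cong (allSubsets n) expand ⟩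
    ∑[ e ← allSubsets n ] (½ * ∑[ K ← tuples5 H ] X e K)       ≡⟨ ∑-*ˡ (allSubsets n) ½ (λ e → ∑ (tuples5 H) (X e)) ⟩
    ½ * ∑[ e ← allSubsets n ] ∑[ K ← tuples5 H ] X e K         ≡⟨ cong (½ *_) (∑-comm (allSubsets n) (tuples5 H) X) ⟩
    ½ * ∑[ K ← tuples5 H ] ∑[ e ← allSubsets n ] X e K         ≡⟨ cong (½ *_) (∑-cong (tuples5 H) factor) ⟩
    ½ * ∑[ K ← tuples5 H ] (𝟙 (clique5ᵇ K) * (weight K * ∑ψ P K)) ∎
    where
    open ≡-Reasoning
    Y : Subset n → ℚ
    Y e = 𝟙 (E H e) * 𝟙 (P ⊆ᵇ e)
    X : Subset n → Vec (Fin n) 5 → ℚ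
    X e K = 𝟙 (clique5ᵇ K) * (weight K * (𝟙 (E H e) * (𝟙 (P ⊆ᵇ e) * ψ H K e)))
    expand : ∀ e → 𝟙 (E H e) * (𝟙 (P ⊆ᵇ e) * w H e) ≡ ½ * ∑[ K ← tuples5 H ] X e K
    expand e = begin
      𝟙 (E H e) * (𝟙 (P ⊆ᵇ e) * w H e)   ≡⟨ cong (λ t → 𝟙 (E H e) * (𝟙 (P ⊆ᵇ e) * t)) (w≡ e) ⟩
      𝟙 (E H e) * (𝟙 (P ⊆ᵇ e) * (½ * ∑[ K ← tuples5 H ] (𝟙 (clique5ᵇ K) * (weight K * ψ H K e))))
        ≡⟨ solve 4 (λ a b h s → a :* (b :* (h :* s)) := h :* ((a :* b) :* s)) refl (𝟙 (E H e)) (𝟙 (P ⊆ᵇ e)) ½ _ ⟩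
      ½ * (Y e * ∑[ K ← tuples5 H ] (𝟙 (clique5ᵇ K) * (weight K * ψ H K e)))
        ≡⟨ cong (½ *_) (sym (∑-*ˡ (tuples5 H) (Y e) _)) ⟩
      ½ * ∑[ K ← tuples5 H ] (Y e * (𝟙 (clique5ᵇ K) * (weight K * ψ H K e)))
        ≡⟨ cong (½ *_) (∑-cong (tuples5 H) λ K →
             solve 5 (λ a b c w p → (a :* b) :* (c :* (w :* p)) := c :* (w :* (a :* (b :* p)))) refl
               (𝟙 (E H e)) (𝟙 (P ⊆ᵇ e)) (𝟙 (clique5ᵇ K)) (weight K) (ψ H K e)) ⟩
      ½ * ∑[ K ← tuples5 H ] X e K ∎
    factor : ∀ K → ∑[ e ← allSubsets n ] X e K ≡ 𝟙 (clique5ᵇ K) * (weight K * ∑ψ P K)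
    factor K = trans (∑-*ˡ (allSubsets n) (𝟙 (clique5ᵇ K)) _) (cong (𝟙 (clique5ᵇ K) *_) (∑-*ˡ (allSubsets n) (weight K) _))

  ∑-tuples5 : (G : Vec (Fin n) 5 → ℚ) → ∑ (tuples5 H) G ≡
    ∑[ a ← allFin n ] ∑[ b ← allFin n ] ∑[ c ← allFin n ] ∑[ d ← allFin n ] ∑[ x ← allFin n ] G (a ∷ b ∷ c ∷ d ∷ x ∷ [])
  ∑-tuples5 G =
    trans (∑-concatMap (allFin n) _ G) $ ∑-cong (allFin n) λ a →
    trans (∑-concatMap (allFin n) _ G) $ ∑-cong (allFin n) λ b →
    trans (∑-concatMap (allFin n) _ G) $ ∑-cong (allFin n) λ c →
    trans (∑-concatMap (allFin n) _ G) $ ∑-cong (allFin n) λ d →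
    ∑-map (allFin n) (λ x → a ∷ b ∷ c ∷ d ∷ x ∷ []) G

  rootedWeight : Fin n → Fin n → ℚ
  rootedWeight a b = ∑[ c ← allFin n ] ∑[ d ← allFin n ] ∑[ x ← allFin n ] (𝟙 (clique5ᵇ (a ∷ b ∷ c ∷ d ∷ x ∷ [])) * W4 H a b c d)

  degw-pair : ∀ {u v} → u ≢ v → degw H (⁅ u ⁆ ∪ ⁅ v ⁆) ≡ ½ * (rootedWeight u v + rootedWeight v u)
  degw-pair {u} {v} u≢v = begin
    degw H (⁅ u ⁆ ∪ ⁅ v ⁆)
      ≡⟨ degw≡ (⁅ u ⁆ ∪ ⁅ v ⁆) ⟩
    ½ * ∑[ K ← tuples5 H ] (𝟙 (clique5ᵇ K) * (weight K * ∑ψ (⁅ u ⁆ ∪ ⁅ v ⁆) K))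
      ≡⟨ cong (½ *_) (∑-cong (tuples5 H) λ K → 𝟙*-cong (clique5ᵇ K) λ clique → cong (weight K *_) (∑ψ-pair′ K clique)) ⟩
    ½ * ∑[ K ← tuples5 H ] (𝟙 (clique5ᵇ K) * (weight K * D (lookup K zero) (lookup K (suc zero))))
      ≡⟨ cong (½ *_) (∑-tuples5 _) ⟩
    ½ * ∑[ a ← allFin n ] ∑[ b ← allFin n ] ∑[ c ← allFin n ] ∑[ d ← allFin n ] ∑[ x ← allFin n ]
          (𝟙 (clique5ᵇ (a ∷ b ∷ c ∷ d ∷ x ∷ [])) * (W4 H a b c d * D a b))
      ≡⟨ cong (½ *_) (∑-cong (allFin n) λ a → ∑-cong (allFin n) λ b → factor a b) ⟩
    ½ * ∑[ a ← allFin n ] ∑[ b ← allFin n ] (D a b * rootedWeight a b)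
      ≡⟨ cong (½ *_) (∑∑-δ-pair u v rootedWeight) ⟩
    ½ * (rootedWeight u v + rootedWeight v u) ∎
    where
    open ≡-Reasoning
    D : Fin n → Fin n → ℚ
    D a b = 𝟙 ((a ≟ᵇ u) ∧ (b ≟ᵇ v)) + 𝟙 ((a ≟ᵇ v) ∧ (b ≟ᵇ u))
    ∑ψ-pair′ : ∀ K → clique5ᵇ K ≡ true → ∑ψ (⁅ u ⁆ ∪ ⁅ v ⁆) K ≡ D (lookup K zero) (lookup K (suc zero))
    ∑ψ-pair′ (a ∷ b ∷ c ∷ d ∷ f ∷ []) clique = ∑ψ-pair H a b c d f (isCliqueᵇ⇒IsClique H clique) u≢v
    factor : ∀ a b →
      ∑[ c ← allFin n ] ∑[ d ← allFin n ] ∑[ x ← allFin n ] (𝟙 (clique5ᵇ (a ∷ b ∷ c ∷ d ∷ x ∷ [])) * (W4 H a b c d * D a b))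
                     ≡ D a b * rootedWeight a b
    factor a b =
      trans (∑-cong (allFin n) (λ c → trans (∑-cong (allFin n) (λ d →
        trans (∑-cong (allFin n) (λ x → solve 3 (λ i w δ → i :* (w :* δ) := δ :* (i :* w)) refl
                                            (𝟙 (clique5ᵇ (a ∷ b ∷ c ∷ d ∷ x ∷ []))) (W4 H a b c d) (D a b)))
              (∑-*ˡ (allFin n) (D a b) _)))
        (∑-*ˡ (allFin n) (D a b) _)))
      (∑-*ˡ (allFin n) (D a b) _)

  rootedWeight≡1 : Codegree>5n/6 H → ∀ {u v} → u ≢ v → 0 ℕ.< deg H (⁅ u ⁆ ∪ ⁅ v ⁆) → rootedWeight u v ≡ 1ℚ
  rootedWeight≡1 codegree {u} {v} u≢v deg>0 = begin
    ∑[ c ← allFin n ] ∑[ d ← allFin n ] ∑[ x ← allFin n ] (𝟙 (clique5ᵇ (u ∷ v ∷ c ∷ d ∷ x ∷ [])) * W4 H u v c d)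
      ≡⟨ ∑-cong (allFin n) (λ c → ∑-cong (allFin n) λ d →
           trans (∑-cong (allFin n) λ x → solve 4 (λ i a b c → i :* (a :* (b :* c)) := ((a :* b) :* c) :* i) refl
                                             (𝟙 (clique5ᵇ (u ∷ v ∷ c ∷ d ∷ x ∷ []))) r₃ (r₄ c) (r₅ c d))
                 (∑-weightedExtensions H (r₃ * r₄ c) (u ∷ v ∷ c ∷ d ∷ []) λ clique →
                    cliques-extend H (u ∷ v ∷ c ∷ d ∷ []) 3≤4 clique codegree ℕ.≤-refl)) ⟩
    ∑[ c ← allFin n ] ∑[ d ← allFin n ] ((r₃ * r₄ c) * 𝟙 (isCliqueᵇ H 4 (toSubset (u ∷ v ∷ c ∷ d ∷ []))))
      ≡⟨ ∑-cong (allFin n) (λ c → ∑-weightedExtensions H r₃ (u ∷ v ∷ c ∷ []) λ clique →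
           cliques-extend H (u ∷ v ∷ c ∷ []) ℕ.≤-refl clique codegree 3≤4) ⟩
    ∑[ c ← allFin n ] (r₃ * 𝟙 (isCliqueᵇ H 3 (toSubset (u ∷ v ∷ c ∷ []))))
      ≡⟨ ∑-cong (allFin n) (λ c → cong (_* 𝟙 (isCliqueᵇ H 3 (toSubset (u ∷ v ∷ c ∷ [])))) (sym (ℚ.*-identityˡ r₃))) ⟩
    ∑[ c ← allFin n ] ((1ℚ * r₃) * 𝟙 (isCliqueᵇ H 3 (toSubset (u ∷ v ∷ c ∷ []))))
      ≡⟨ ∑-weightedExtensions H 1ℚ (u ∷ v ∷ []) (λ _ → deg>0⇒numCliques3>0 H deg>0) ⟩
    1ℚ * 𝟙 (isCliqueᵇ H 2 (⁅ u ⁆ ∪ ⁅ v ⁆))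
      ≡⟨ cong (λ b → 1ℚ * 𝟙 b) (IsClique⇒isCliqueᵇ H (pair-IsClique H u≢v)) ⟩
    1ℚ ∎
    where
    open ≡-Reasoning
    r₃ : ℚ
    r₃ = recip (numCliques H 3 (⁅ u ⁆ ∪ ⁅ v ⁆))
    r₄ : Fin n → ℚ
    r₄ c = recip (numCliques H 4 (⁅ u ⁆ ∪ ⁅ v ⁆ ∪ ⁅ c ⁆))
    r₅ : Fin n → Fin n → ℚ
    r₅ c d = recip (numCliques H 5 (⁅ u ⁆ ∪ ⁅ v ⁆ ∪ ⁅ c ⁆ ∪ ⁅ d ⁆))
    3≤4 : 3 ℕ.≤ 4
    3≤4 = ℕ.n≤1+n 3

  degw≡1 : Codegree>5n/6 H → ∀ {u v} → u ≢ v → 0 ℕ.< deg H (⁅ u ⁆ ∪ ⁅ v ⁆) → degw H (⁅ u ⁆ ∪ ⁅ v ⁆) ≡ 1ℚ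
  degw≡1 codegree {u} {v} u≢v deg>0 = begin
    degw H (⁅ u ⁆ ∪ ⁅ v ⁆)                   ≡⟨ degw-pair u≢v ⟩
    ½ * (rootedWeight u v + rootedWeight v u) ≡⟨ cong₂ (λ s t → ½ * (s + t)) (rootedWeight≡1 codegree u≢v deg>0)
                                                   (rootedWeight≡1 codegree (u≢v ∘ sym) (subst (λ p → 0 ℕ.< deg H p) (∪-comm ⁅ u ⁆ ⁅ v ⁆) deg>0)) ⟩
    ½ * (1ℚ + 1ℚ)                             ≡⟨⟩
    1ℚ                                        ∎
    where open ≡-Reasoning

open import Data.Nat using (ℕ; _≤_; _<_; _*_)

proposition2p10 : (n : ℕ) → 5 ≤ n → (H : Hypergraph3 n) →
    ((p : Subset n) → ∣ p ∣ ≡ 2 → 0 < deg H p → 5 * n < 6 * deg H p) →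
    (p : Subset n) → ∣ p ∣ ≡ 2 → 0 < deg H p → degw H p ≡ 1ℚ
proposition2p10 n _ H codegree p ∣p∣≡2 deg>0 with ∣p∣≡2⇒pair {p = p} ∣p∣≡2
... | u , v , u≢v , refl = degw≡1 H codegree u≢v deg>0
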